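{- For every integer $k\geq 1$, the set $G_k$ coincides with the set of maximal clean compact elements of $\hat B_k^{(prd)}$.
   Context: A peg permutation of length $n$ is a word $\pi_1^{\varepsilon_1}\cdots\pi_n^{\varepsilon_n}$ where $\pi_1\cdots\pi_n$ is a permutation of $\{1,\dots,n\}$ in one-line notation and each $\varepsilon_i\in\{+,-,\bullet\}$. An increasing (resp. decreasing) strip is a maximal factor of consecutive positions in which each value is one more (resp. one less) than the previous and all entries are decorated $+$ or $\bullet$ (resp. $-$ or $\bullet$); a peg permutation is clean compact if all strips have length $1$. An identity peg permutation has identity underlying permutation and decorations in $\{+,\bullet\}$. A prefix reversal of a peg permutation reverses a prefix $\pi_1\cdots\pi_j$ and swaps $+\leftrightarrow -$ on the reversed entries ($\bullet$ unchanged); $prd(\pi^\varepsilon)$ is the minimum number of prefix reversals turning $\pi^\varepsilon$ into an identity peg permutation of the same length; $\hat B_k^{(prd)}$ is the set of peg permutations with $prd\le k$. Peg pattern order: $\sigma^\delta$ of length $m$ is a pattern of $\tau^\varepsilon$ if there are $i_1<\dots<i_m$ with $\tau_{i_1}\cdots\tau_{i_m}$ order-isomorphic to $\sigma$ and, for each $j$, $\delta_j\in\{+,-\}$ implies $\varepsilon_{i_j}=\delta_j$. A maximal clean compact element of a set $X$ is a clean compact element of $X$ not a proper pattern of any other clean compact element of $X$. The sets $G_k$ (the generating permutations of the prefix reversal model) are defined recursively: $G_1=\{1^-2^+\}$. Given $\pi^\varepsilon\in G_k$ and a position $i$ with $\varepsilon_i\in\{+,-\}$, write $\pi^\varepsilon=\alpha\,\pi_i^{\varepsilon_i}\,\beta$;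 let $\dot\alpha,\dot\beta$ be obtained from $\alpha,\beta$ by adding $1$ to every value greater than $\pi_i$ (decorations kept), and $\dot\alpha^R$ be $\dot\alpha$ written in reverse order with $+$ and $-$ swapped. If $\varepsilon_i=+$ produce $\pi_i^-\,\dot\alpha^R\,(\pi_i+1)^+\,\dot\beta$; if $\varepsilon_i=-$ produce $(\pi_i+1)^+\,\dot\alpha^R\,\pi_i^-\,\dot\beta$. $G_{k+1}$ is the set of all peg permutations so produced from elements of $G_k$ (e.g. $G_2=\{2^+1^-3^+,\,2^-1^+3^+\}$). -}

module Defs where

open import Data.Nat using (ℕ; zero; suc; _<_; _≤_; _<ᵇ_)
open import Data.Bool using (if_then_else_)
open import Data.Product using (_×_; _,_; Σ; ∃; ∃-syntax; proj₁; proj₂)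
open import Data.Sum using (_⊎_)
open import Data.List using (List; []; _∷_; _++_; map; reverse; take; drop; length; foldl; upTo)
open import Data.List.Relation.Unary.All using (All)
open import Data.List.Relation.Binary.Pointwise using (Pointwise)
open import Data.List.Relation.Binary.Sublist.Propositional using (_⊆_)
open import Data.List.Relation.Binary.Permutation.Propositional using (_↭_)
open import Relation.Binary.PropositionalEquality using (_≡_; _≢_)
open import Relation.Nullary using (¬_)
open import Function.Bundles using (_⇔_)

-- Decorations: pos = +, neg = -, dot = •
data Sign : Set where
  pos neg dot : Sign

flip : Sign → Sign
flip pos = neg
flip neg = pos
flip dot = dot

Entry : Set
Entry = ℕ × Sign

Word : Set
Word = List Entry

vals : Word → List ℕ
vals = map proj₁

oneTo : ℕ → List ℕ
oneTo n = map suc (upTo n)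

IsPeg : Word → Set
IsPeg p = vals p ↭ oneTo (length p)

IsIdentityPeg : Word → Set
IsIdentityPeg p = (vals p ≡ oneTo (length p)) × All (λ e → proj₂ e ≢ neg) p

revFlip : Word → Word
revFlip a = map (λ e → proj₁ e , flip (proj₂ e)) (reverse a)

prefixRev : ℕ → Word → Word
prefixRev j p = revFlip (take j p) ++ drop j p

applyRevs : Word → List ℕ → Word
applyRevs p js = foldl (λ q j → prefixRev j q) p js

PrdAtMost : ℕ → Word → Set
PrdAtMost k p = ∃[ js ] (length js ≤ k) × All (λ j → 1 ≤ j × j ≤ length p) js
                        × IsIdentityPeg (applyRevs p js)

InB : ℕ → Word → Set
InB k p = IsPeg p × PrdAtMost k p

IncLink : Entry → Entry → Set
IncLink (a , s) (b , t) = (b ≡ suc a) × (s ≢ neg) × (t ≢ neg)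

DecLink : Entry → Entry → Set
DecLink (a , s) (b , t) = (a ≡ suc b) × (s ≢ pos) × (t ≢ pos)

-- all strips have length 1, i.e. no two adjacent entries lie in a common strip
data CleanCompact : Word → Set where
  cc-nil  : CleanCompact []
  cc-one  : ∀ e → CleanCompact (e ∷ [])
  cc-cons : ∀ e f w → ¬ IncLink e f → ¬ DecLink e f →
            CleanCompact (f ∷ w) → CleanCompact (e ∷ f ∷ w)

data OrderIso : List ℕ → List ℕ → Set where
  oi-nil  : OrderIso [] []
  oi-cons : ∀ {x y xs ys} →
            Pointwise (λ x' y' → ((x < x') ⇔ (y < y')) × ((x' < x) ⇔ (y' < y))) xs ys →
            OrderIso xs ys → OrderIso (x ∷ xs) (y ∷ ys)

SignOK : Entry → Entry → Set
SignOK (_ , δ) (_ , ε) = (δ ≡ dot) ⊎ (ε ≡ δ)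

IsPattern : Word → Word → Set
IsPattern σ τ = ∃[ τ' ] (τ' ⊆ τ) × OrderIso (vals σ) (vals τ') × Pointwise SignOK σ τ'

MaxCleanCompact : ℕ → Word → Set
MaxCleanCompact k p = InB k p × CleanCompact p ×
  (∀ q → InB k q → CleanCompact q → IsPattern p q → p ≡ q)

bump : ℕ → Word → Word
bump v = map (λ e → (if v <ᵇ proj₁ e then suc (proj₁ e) else proj₁ e) , proj₂ e)

data Step : Word → Word → Set where
  step+ : ∀ α v β → Step (α ++ (v , pos) ∷ β)
                         ((v , neg) ∷ revFlip (bump v α) ++ (suc v , pos) ∷ bump v β)
  step- : ∀ α v β → Step (α ++ (v , neg) ∷ β)
                         ((suc v , pos) ∷ revFlip (bump v α) ++ (v , neg) ∷ bump v β)

data G : ℕ → Word → Set where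
  g1 : G 1 ((1 , neg) ∷ (2 , pos) ∷ [])
  gs : ∀ {k p q} → G k p → Step p q → G (suc k) q

-- Every element of G_k is undotted, clean compact, of length k+1 and sortable by k prefix
-- reversals, since one reversal turns the step of p at an entry into the inflation of p at that
-- entry. Conversely, let q be clean compact and sortable by k reversals. Replacing its dots we may
-- assume q undotted, and then, by induction on the number of reversals, q arises from an element
-- of G_k by deleting values: after the first reversal the word is either still clean compact, or
-- it has a strip of length two at the junction, which one deletion contracts; in both cases one
-- more step applied to the word given by induction yields q up to deletions. Deletions are
-- patterns, so every clean compact element of B_k is a pattern of an element of G_k, whose
-- length k+1 is therefore maximal; and a pattern of a peg permutation of the same length
-- coincides with it.

module Submission where

open import Defs
open import Data.Nat
open import Data.Nat.Properties
open import Data.Bool using (true; false; if_then_else_; T)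
open import Data.Unit using (tt; ⊤)
open import Data.Empty using (⊥; ⊥-elim)
open import Data.Product using (_×_; _,_; ∃; ∃-syntax; ∃₂; proj₁; proj₂)
open import Data.Sum using (_⊎_; inj₁; inj₂)
open import Data.List using (List; []; _∷_; _++_; map; reverse; take; drop; length; [_]; applyUpTo)
open import Data.List.Properties using (map-++; reverse-++; length-map; length-++; unfold-reverse; take++drop≡id; ++-assoc; reverse-involutive; reverse-map; map-applyUpTo; length-reverse; ++-identityʳ; ∷-injective; foldl-++; length-take)
open import Data.List.Relation.Unary.All using (All; []; _∷_)
import Data.List.Relation.Unary.All as All
import Data.List.Relation.Unary.All.Properties as AllP
open import Data.List.Relation.Unary.AllPairs using ([]; _∷_)
open import Data.List.Relation.Unary.Unique.Propositional using (Unique)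
import Data.List.Relation.Unary.Unique.Propositional.Properties as UP
open import Data.List.Relation.Binary.Permutation.Propositional using (_↭_; ↭-refl; ↭-sym; ↭-trans; ↭-reflexive; module PermutationReasoning)
import Data.List.Relation.Binary.Permutation.Propositional as ↭
open import Data.List.Relation.Binary.Permutation.Propositional.Properties using (++⁺ʳ; All-resp-↭; Any-resp-↭; ↭-reverse)
open import Data.List.Relation.Binary.Pointwise using (Pointwise; []; _∷_)
import Data.List.Relation.Binary.Pointwise as PW
open import Data.List.Relation.Binary.Sublist.Propositional using (_⊆_; []; _∷_; _∷ʳ_; ⊆-refl; ⊆-trans)
import Data.List.Relation.Binary.Sublist.Propositional as Sublist
import Data.List.Relation.Binary.Sublist.Propositional.Properties as SublistP
open import Data.List.Membership.Propositional using (_∈_)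
open import Data.List.Membership.Propositional.Properties using (∈-++⁻; ∈-++⁺ʳ; ∈-∃++; ∈-map⁺)
open import Data.List.Relation.Unary.Any using (here; there)
open import Relation.Binary.PropositionalEquality hiding ([_])
open import Relation.Binary.Definitions using (tri<; tri≈; tri>)
open import Relation.Nullary using (¬_; Dec; yes; no)
open import Relation.Nullary.Decidable using (_×-dec_; ¬?)
open import Function.Bundles using (_⇔_; mk⇔; Equivalence)

-- Prefix reversals

flipEntry : Entry → Entry
flipEntry e = proj₁ e , flip (proj₂ e)

flip-involutive : ∀ s → flip (flip s) ≡ s
flip-involutive pos = refl
flip-involutive neg = refl
flip-involutive dot = refl

flipEntry-involutive : ∀ e → flipEntry (flipEntry e) ≡ e
flipEntry-involutive (x , s) = cong (x ,_) (flip-involutive s)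

revFlip-++ : ∀ xs ys → revFlip (xs ++ ys) ≡ revFlip ys ++ revFlip xs
revFlip-++ xs ys = trans (cong (map flipEntry) (reverse-++ xs ys)) (map-++ flipEntry (reverse ys) (reverse xs))

revFlip-∷ : ∀ x xs → revFlip (x ∷ xs) ≡ revFlip xs ++ [ flipEntry x ]
revFlip-∷ x xs = revFlip-++ [ x ] xs

revFlip-∷ʳ : ∀ xs x → revFlip (xs ++ [ x ]) ≡ flipEntry x ∷ revFlip xs
revFlip-∷ʳ xs x = revFlip-++ xs [ x ]

revFlip-involutive : ∀ xs → revFlip (revFlip xs) ≡ xs
revFlip-involutive [] = refl
revFlip-involutive (x ∷ xs) = begin
  revFlip (revFlip (x ∷ xs))            ≡⟨ cong revFlip (revFlip-∷ x xs) ⟩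
  revFlip (revFlip xs ++ [ flipEntry x ]) ≡⟨ revFlip-∷ʳ (revFlip xs) (flipEntry x) ⟩
  flipEntry (flipEntry x) ∷ revFlip (revFlip xs) ≡⟨ cong₂ _∷_ (flipEntry-involutive x) (revFlip-involutive xs) ⟩
  x ∷ xs                                ∎
  where open ≡-Reasoning

length-revFlip : ∀ xs → length (revFlip xs) ≡ length xs
length-revFlip xs = trans (length-map flipEntry (reverse xs)) (length-reverse xs)

prefixRev-++ : ∀ xs ys → prefixRev (length xs) (xs ++ ys) ≡ revFlip xs ++ ys
prefixRev-++ xs ys = cong₂ (λ a b → revFlip a ++ b) (take-length-++ xs) (drop-length-++ xs)
  where
  take-length-++ : ∀ xs → take (length xs) (xs ++ ys) ≡ xs
  take-length-++ [] = refl
  take-length-++ (x ∷ xs) = cong (x ∷_) (take-length-++ xs)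
  drop-length-++ : ∀ xs → drop (length xs) (xs ++ ys) ≡ ys
  drop-length-++ [] = refl
  drop-length-++ (x ∷ xs) = drop-length-++ xs

length-prefixRev : ∀ j w → length (prefixRev j w) ≡ length w
length-prefixRev j w = begin
  length (revFlip (take j w) ++ drop j w)            ≡⟨ length-++ (revFlip (take j w)) ⟩
  length (revFlip (take j w)) + length (drop j w)    ≡⟨ cong (_+ length (drop j w)) (length-revFlip (take j w)) ⟩
  length (take j w) + length (drop j w)              ≡⟨ sym (length-++ (take j w)) ⟩
  length (take j w ++ drop j w)                      ≡⟨ cong length (take++drop≡id j w) ⟩
  length w                                           ∎
  where open ≡-Reasoning

prefixRev-⊓ : ∀ j w → prefixRev j w ≡ prefixRev (j ⊓ length w) w
prefixRev-⊓ j w = cong₂ (λ a b → revFlip a ++ b) (take-⊓ j w) (drop-⊓ j w)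
  where
  take-⊓ : ∀ j (w : Word) → take j w ≡ take (j ⊓ length w) w
  take-⊓ zero w = refl
  take-⊓ (suc j) [] = refl
  take-⊓ (suc j) (x ∷ w) = cong (x ∷_) (take-⊓ j w)
  drop-⊓ : ∀ j (w : Word) → drop j w ≡ drop (j ⊓ length w) w
  drop-⊓ zero w = refl
  drop-⊓ (suc j) [] = refl
  drop-⊓ (suc j) (x ∷ w) = drop-⊓ j w

prefixRev-involutive : ∀ j w → prefixRev j (prefixRev j w) ≡ w
prefixRev-involutive j w = begin
  prefixRev j (prefixRev j w)                                ≡⟨ prefixRev-⊓ j (prefixRev j w) ⟩
  prefixRev (j ⊓ length (prefixRev j w)) (prefixRev j w)     ≡⟨ cong (λ n → prefixRev (j ⊓ n) (prefixRev j w)) (length-prefixRev j w) ⟩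
  prefixRev (j ⊓ length w) (revFlip (take j w) ++ drop j w)  ≡⟨ cong (λ n → prefixRev n (revFlip (take j w) ++ drop j w)) length-prefix ⟩
  prefixRev (length (revFlip (take j w))) (revFlip (take j w) ++ drop j w) ≡⟨ prefixRev-++ (revFlip (take j w)) (drop j w) ⟩
  revFlip (revFlip (take j w)) ++ drop j w                   ≡⟨ cong (_++ drop j w) (revFlip-involutive (take j w)) ⟩
  take j w ++ drop j w                                       ≡⟨ take++drop≡id j w ⟩
  w                                                          ∎
  where
  open ≡-Reasoning
  length-prefix : j ⊓ length w ≡ length (revFlip (take j w))
  length-prefix = sym (trans (length-revFlip (take j w)) (length-take j w))

length-applyRevs : ∀ w js → length (applyRevs w js) ≡ length w
length-applyRevs w [] = refl
length-applyRevs w (j ∷ js) = trans (length-applyRevs (prefixRev j w) js) (length-prefixRev j w)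

applyRevs-reverse : ∀ js w → applyRevs (applyRevs w js) (reverse js) ≡ w
applyRevs-reverse [] w = refl
applyRevs-reverse (j ∷ js) w = begin
  applyRevs (applyRevs (prefixRev j w) js) (reverse (j ∷ js))         ≡⟨ cong (applyRevs _) (unfold-reverse j js) ⟩
  applyRevs (applyRevs (prefixRev j w) js) (reverse js ++ [ j ])      ≡⟨ foldl-++ (λ q j → prefixRev j q) _ (reverse js) [ j ] ⟩
  prefixRev j (applyRevs (applyRevs (prefixRev j w) js) (reverse js)) ≡⟨ cong (prefixRev j) (applyRevs-reverse js (prefixRev j w)) ⟩
  prefixRev j (prefixRev j w)                                         ≡⟨ prefixRev-involutive j w ⟩
  w                                                                   ∎
  where open ≡-Reasoning

FlipClosed : (Entry → Set) → Set
FlipClosed P = ∀ e → P e → P (flipEntry e)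

All-revFlip : ∀ {P} → FlipClosed P → ∀ xs → All P xs → All P (revFlip xs)
All-revFlip closed xs a = AllP.map⁺ (All.map (closed _) (All-resp-↭ (↭-sym (↭-reverse xs)) a))

All-prefixRev : ∀ {P} → FlipClosed P → ∀ j w → All P w → All P (prefixRev j w)
All-prefixRev closed j w a = AllP.++⁺ (All-revFlip closed (take j w) (AllP.take⁺ j a)) (AllP.drop⁺ j a)

All-applyRevs : ∀ {P} → FlipClosed P → ∀ w js → All P w → All P (applyRevs w js)
All-applyRevs closed w [] a = a
All-applyRevs closed w (j ∷ js) a = All-applyRevs closed (prefixRev j w) js (All-prefixRev closed j w a)

substitute : (Entry → Word) → Word → Word
substitute f [] = []
substitute f (e ∷ w) = f e ++ substitute f w

substitute-++ : ∀ f xs ys → substitute f (xs ++ ys) ≡ substitute f xs ++ substitute f ys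
substitute-++ f [] ys = refl
substitute-++ f (x ∷ xs) ys = trans (cong (f x ++_) (substitute-++ f xs ys)) (sym (++-assoc (f x) (substitute f xs) (substitute f ys)))

FlipEquivariant : (Entry → Word) → Entry → Set
FlipEquivariant f e = revFlip (f e) ≡ f (flipEntry e)

substitute-revFlip : ∀ f xs → All (FlipEquivariant f) xs → substitute f (revFlip xs) ≡ revFlip (substitute f xs)
substitute-revFlip f [] a = refl
substitute-revFlip f (x ∷ xs) (eq ∷ a) = begin
  substitute f (revFlip (x ∷ xs))                    ≡⟨ cong (substitute f) (revFlip-∷ x xs) ⟩
  substitute f (revFlip xs ++ [ flipEntry x ])        ≡⟨ substitute-++ f (revFlip xs) [ flipEntry x ] ⟩
  substitute f (revFlip xs) ++ (f (flipEntry x) ++ []) ≡⟨ cong₂ _++_ (substitute-revFlip f xs a) (++-identityʳ (f (flipEntry x))) ⟩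
  revFlip (substitute f xs) ++ f (flipEntry x)        ≡⟨ cong (revFlip (substitute f xs) ++_) (sym eq) ⟩
  revFlip (substitute f xs) ++ revFlip (f x)          ≡⟨ sym (revFlip-++ (f x) (substitute f xs)) ⟩
  revFlip (f x ++ substitute f xs)                    ∎
  where open ≡-Reasoning

substitute-prefixRev : ∀ f j w → All (FlipEquivariant f) w →
  substitute f (prefixRev j w) ≡ prefixRev (length (substitute f (take j w))) (substitute f w)
substitute-prefixRev f j w a = begin
  substitute f (revFlip (take j w) ++ drop j w)                     ≡⟨ substitute-++ f (revFlip (take j w)) (drop j w) ⟩
  substitute f (revFlip (take j w)) ++ substitute f (drop j w)       ≡⟨ cong (_++ substitute f (drop j w)) (substitute-revFlip f (take j w) (AllP.take⁺ j a)) ⟩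
  revFlip (substitute f (take j w)) ++ substitute f (drop j w)       ≡⟨ sym (prefixRev-++ (substitute f (take j w)) (substitute f (drop j w))) ⟩
  prefixRev n (substitute f (take j w) ++ substitute f (drop j w))   ≡⟨ cong (prefixRev n) (sym (substitute-++ f (take j w) (drop j w))) ⟩
  prefixRev n (substitute f (take j w ++ drop j w))                 ≡⟨ cong (λ u → prefixRev n (substitute f u)) (take++drop≡id j w) ⟩
  prefixRev n (substitute f w)                                      ∎
  where
  open ≡-Reasoning
  n = length (substitute f (take j w))

liftRevs : (Entry → Word) → Word → List ℕ → List ℕ
liftRevs f w [] = []
liftRevs f w (j ∷ js) = length (substitute f (take j w)) ∷ liftRevs f (prefixRev j w) js

length-liftRevs : ∀ f w js → length (liftRevs f w js) ≡ length js
length-liftRevs f w [] = refl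
length-liftRevs f w (j ∷ js) = cong suc (length-liftRevs f (prefixRev j w) js)

applyRevs-substitute : ∀ f {P} → FlipClosed P → (∀ e → P e → FlipEquivariant f e) → ∀ w js → All P w →
  applyRevs (substitute f w) (liftRevs f w js) ≡ substitute f (applyRevs w js)
applyRevs-substitute f closed equivariant w [] a = refl
applyRevs-substitute f closed equivariant w (j ∷ js) a =
  trans (cong (λ u → applyRevs u (liftRevs f (prefixRev j w) js)) (sym (substitute-prefixRev f j w (All.map (equivariant _) a))))
        (applyRevs-substitute f closed equivariant (prefixRev j w) js (All-prefixRev closed j w a))

Sortable : ℕ → Word → Set
Sortable k w = ∃[ js ] (length js ≤ k) × IsIdentityPeg (applyRevs w js)

sortable-substitute : ∀ f {P} → FlipClosed P → (∀ e → P e → FlipEquivariant f e) →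
  (∀ z → All P z → IsIdentityPeg z → IsIdentityPeg (substitute f z)) →
  ∀ k w → All P w → Sortable k w → Sortable k (substitute f w)
sortable-substitute f closed equivariant identity k w a (js , l , i) =
  liftRevs f w js , subst (_≤ k) (sym (length-liftRevs f w js)) l ,
  subst IsIdentityPeg (sym (applyRevs-substitute f closed equivariant w js a)) (identity (applyRevs w js) (All-applyRevs closed w js a) i)

normaliseRevs : Word → List ℕ → List ℕ
normaliseRevs w [] = []
normaliseRevs w (j ∷ js) with j ⊓ length w
... | zero = normaliseRevs w js
... | suc m = suc m ∷ normaliseRevs (prefixRev (suc m) w) js

normaliseRevs-correct : ∀ w js → (applyRevs w (normaliseRevs w js) ≡ applyRevs w js) × (length (normaliseRevs w js) ≤ length js)
  × All (λ j → 1 ≤ j × j ≤ length w) (normaliseRevs w js)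
normaliseRevs-correct w [] = refl , z≤n , []
normaliseRevs-correct w (j ∷ js) with j ⊓ length w in eq
... | zero = let (same , shorter , inRange) = normaliseRevs-correct w js in
  trans same (cong (λ u → applyRevs u js) (sym (trans (prefixRev-⊓ j w) (cong (λ n → prefixRev n w) eq)))) ,
  m≤n⇒m≤1+n shorter , inRange
... | suc m = let (same , shorter , inRange) = normaliseRevs-correct (prefixRev (suc m) w) js in
  trans same (cong (λ u → applyRevs u js) (sym (trans (prefixRev-⊓ j w) (cong (λ n → prefixRev n w) eq)))) ,
  s≤s shorter ,
  (s≤s z≤n , subst (_≤ length w) eq (m⊓n≤n j (length w))) ∷
    subst (λ n → All (λ j → 1 ≤ j × j ≤ n) (normaliseRevs (prefixRev (suc m) w) js)) (length-prefixRev (suc m) w) inRange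

sortable⇒prdAtMost : ∀ k w → Sortable k w → PrdAtMost k w
sortable⇒prdAtMost k w (js , l , i) = let (same , shorter , inRange) = normaliseRevs-correct w js in
  normaliseRevs w js , ≤-trans shorter l , inRange , subst IsIdentityPeg (sym same) i

prdAtMost⇒sortable : ∀ k w → PrdAtMost k w → Sortable k w
prdAtMost⇒sortable k w (js , l , _ , i) = js , l , i

-- Deleting and inflating a value

raise : ℕ → ℕ → ℕ
raise v y = if v <ᵇ y then suc y else y

lower : ℕ → ℕ → ℕ
lower v y = if v <ᵇ y then pred y else y

raise-≤ : ∀ {v y} → y ≤ v → raise v y ≡ y
raise-≤ {v} {y} y≤v with v <ᵇ y in eq
... | false = refl
... | true = ⊥-elim (<⇒≱ (<ᵇ⇒< v y (subst T (sym eq) tt)) y≤v)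

raise-> : ∀ {v y} → v < y → raise v y ≡ suc y
raise-> {v} {y} v<y with v <ᵇ y in eq
... | true = refl
... | false = ⊥-elim (subst T eq (<⇒<ᵇ v<y))

lower-≤ : ∀ {v y} → y ≤ v → lower v y ≡ y
lower-≤ {v} {y} y≤v with v <ᵇ y in eq
... | false = refl
... | true = ⊥-elim (<⇒≱ (<ᵇ⇒< v y (subst T (sym eq) tt)) y≤v)

lower-> : ∀ {v y} → v < y → lower v y ≡ pred y
lower-> {v} {y} v<y with v <ᵇ y in eq
... | true = refl
... | false = ⊥-elim (subst T eq (<⇒<ᵇ v<y))

deleteEntry : ℕ → Entry → Word
deleteEntry v (y , t) = if y ≡ᵇ v then [] else ((lower v y , t) ∷ [])

strip : ℕ → Sign → Word
strip c pos = (c , pos) ∷ (suc c , pos) ∷ []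
strip c neg = (suc c , neg) ∷ (c , neg) ∷ []
strip c dot = (c , dot) ∷ (suc c , dot) ∷ []

inflateEntry : ℕ → Entry → Word
inflateEntry c (y , t) = if y ≡ᵇ c then strip c t else ((raise c y , t) ∷ [])

delete : ℕ → Word → Word
delete v = substitute (deleteEntry v)

inflate : ℕ → Word → Word
inflate c = substitute (inflateEntry c)

deleteEntry-self : ∀ v t → deleteEntry v (v , t) ≡ []
deleteEntry-self v t with v ≡ᵇ v in eq
... | true = refl
... | false = ⊥-elim (subst T eq (≡⇒≡ᵇ v v refl))

deleteEntry-other : ∀ {v y} t → y ≢ v → deleteEntry v (y , t) ≡ (lower v y , t) ∷ []
deleteEntry-other {v} {y} t ne with y ≡ᵇ v in eq
... | false = refl
... | true = ⊥-elim (ne (≡ᵇ⇒≡ y v (subst T (sym eq) tt)))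

deleteEntry-below : ∀ {v y} t → y < v → deleteEntry v (y , t) ≡ (y , t) ∷ []
deleteEntry-below t y<v = trans (deleteEntry-other t (<⇒≢ y<v)) (cong (λ z → (z , t) ∷ []) (lower-≤ (<⇒≤ y<v)))

deleteEntry-above : ∀ {v y} t → v < y → deleteEntry v (y , t) ≡ (pred y , t) ∷ []
deleteEntry-above t v<y = trans (deleteEntry-other t (>⇒≢ v<y)) (cong (λ z → (z , t) ∷ []) (lower-> v<y))

inflateEntry-self : ∀ c t → inflateEntry c (c , t) ≡ strip c t
inflateEntry-self c t with c ≡ᵇ c in eq
... | true = refl
... | false = ⊥-elim (subst T eq (≡⇒≡ᵇ c c refl))

inflateEntry-other : ∀ {c y} t → y ≢ c → inflateEntry c (y , t) ≡ (raise c y , t) ∷ []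
inflateEntry-other {c} {y} t ne with y ≡ᵇ c in eq
... | false = refl
... | true = ⊥-elim (ne (≡ᵇ⇒≡ y c (subst T (sym eq) tt)))

Undotted : Entry → Set
Undotted e = proj₂ e ≢ dot

Undotted-flipClosed : FlipClosed Undotted
Undotted-flipClosed (x , pos) p = λ ()
Undotted-flipClosed (x , neg) p = λ ()
Undotted-flipClosed (x , dot) p = ⊥-elim (p refl)

deleteEntry-equivariant : ∀ v e → FlipEquivariant (deleteEntry v) e
deleteEntry-equivariant v (y , t) with y ≡ᵇ v
... | true = refl
... | false = refl

inflateEntry-equivariant : ∀ c e → Undotted e → FlipEquivariant (inflateEntry c) e
inflateEntry-equivariant c (y , t) df with y ≡ᵇ c
... | false = refl
inflateEntry-equivariant c (y , pos) df | true = refl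
inflateEntry-equivariant c (y , neg) df | true = refl
inflateEntry-equivariant c (y , dot) df | true = ⊥-elim (df refl)

consecutive : ℕ → ℕ → List ℕ
consecutive m zero = []
consecutive m (suc n) = m ∷ consecutive (suc m) n

applyUpTo≡consecutive : ∀ f m n → (∀ i → f i ≡ m + i) → applyUpTo f n ≡ consecutive m n
applyUpTo≡consecutive f m zero _ = refl
applyUpTo≡consecutive f m (suc n) f≗ = cong₂ _∷_ (trans (f≗ 0) (+-identityʳ m))
  (applyUpTo≡consecutive (λ i → f (suc i)) (suc m) n (λ i → trans (f≗ (suc i)) (+-suc m i)))

oneTo≡consecutive : ∀ n → oneTo n ≡ consecutive 1 n
oneTo≡consecutive n = trans (map-applyUpTo (λ i → i) suc n) (applyUpTo≡consecutive suc 1 n (λ _ → refl))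

All-substitute : ∀ {Q : Entry → Set} f → (∀ e → Q e → All Q (f e)) → ∀ w → All Q w → All Q (substitute f w)
All-substitute f h [] [] = []
All-substitute f h (x ∷ w) (q ∷ a) = AllP.++⁺ (h x q) (All-substitute f h w a)

delete-consecutive-above : ∀ v z m → v < m → vals z ≡ consecutive m (length z) →
  (vals (delete v z) ≡ consecutive (pred m) (length z)) × (length (delete v z) ≡ length z)
delete-consecutive-above v [] m lt e = refl , refl
delete-consecutive-above v ((y , t) ∷ z) m lt e with ∷-injective e
... | refl , e' rewrite deleteEntry-other {v} {m} t (λ q → <-irrefl (sym q) lt) | lower-> lt =
  let (a , b) = delete-consecutive-above v z (suc m) (m<n⇒m<1+n lt) e' in
  cong₂ _∷_ refl (trans a (cong (λ k → consecutive k (length z)) (sym (suc-pred m {{>-nonZero (≤-trans (s≤s z≤n) lt)}})))) , cong suc b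

delete-consecutive : ∀ v z m → m ≤ v → vals z ≡ consecutive m (length z) → vals (delete v z) ≡ consecutive m (length (delete v z))
delete-consecutive v [] m le e = refl
delete-consecutive v ((y , t) ∷ z) m le e with ∷-injective e
... | refl , e' with m ≟ v
... | yes refl rewrite deleteEntry-self m t = let (a , b) = delete-consecutive-above m z (suc m) ≤-refl e' in trans a (cong (consecutive m) (sym b))
... | no ne rewrite deleteEntry-other {v} {m} t ne | lower-≤ le =
  cong (m ∷_) (delete-consecutive v z (suc m) (≤∧≢⇒< le ne) e')

inflate-consecutive-above : ∀ c z m → c < m → vals z ≡ consecutive m (length z) →
  (vals (inflate c z) ≡ consecutive (suc m) (length z)) × (length (inflate c z) ≡ length z)
inflate-consecutive-above c [] m lt e = refl , refl
inflate-consecutive-above c ((y , t) ∷ z) m lt e with ∷-injective e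
... | refl , e' rewrite inflateEntry-other {c} {m} t (λ q → <-irrefl (sym q) lt) | raise-> lt =
  let (a , b) = inflate-consecutive-above c z (suc m) (m<n⇒m<1+n lt) e' in cong (suc m ∷_) a , cong suc b

inflate-consecutive : ∀ c z m → m ≤ c → All (λ e → proj₂ e ≢ neg) z → vals z ≡ consecutive m (length z) →
  vals (inflate c z) ≡ consecutive m (length (inflate c z))
inflate-consecutive c [] m le _ e = refl
inflate-consecutive c ((y , t) ∷ z) m le (nn ∷ a) e with ∷-injective e
... | refl , e' with m ≟ c
... | yes refl rewrite inflateEntry-self m t = helper t nn
  where
  ab = inflate-consecutive-above m z (suc m) ≤-refl e'
  helper : ∀ t → t ≢ neg → vals (strip m t ++ inflate m z) ≡ consecutive m (length (strip m t ++ inflate m z))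
  helper pos _ = cong (λ u → m ∷ suc m ∷ u) (trans (proj₁ ab) (cong (consecutive (suc (suc m))) (sym (proj₂ ab))))
  helper neg nn = ⊥-elim (nn refl)
  helper dot _ = cong (λ u → m ∷ suc m ∷ u) (trans (proj₁ ab) (cong (consecutive (suc (suc m))) (sym (proj₂ ab))))
... | no ne rewrite inflateEntry-other {c} {m} t ne | raise-≤ le =
  cong (m ∷_) (inflate-consecutive c z (suc m) (≤∧≢⇒< le ne) a e')

delete-identity : ∀ v → 1 ≤ v → ∀ z → IsIdentityPeg z → IsIdentityPeg (delete v z)
delete-identity v le z (e , a) =
  trans (delete-consecutive v z 1 le (trans e (oneTo≡consecutive (length z)))) (sym (oneTo≡consecutive _)) ,
  All-substitute (deleteEntry v) h z a
  where
  h : ∀ e → proj₂ e ≢ neg → All (λ e → proj₂ e ≢ neg) (deleteEntry v e)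
  h (y , t) nn with y ≡ᵇ v
  ... | true = []
  ... | false = nn ∷ []

inflate-identity : ∀ c → 1 ≤ c → ∀ z → IsIdentityPeg z → IsIdentityPeg (inflate c z)
inflate-identity c le z (e , a) =
  trans (inflate-consecutive c z 1 le a (trans e (oneTo≡consecutive (length z)))) (sym (oneTo≡consecutive _)) ,
  All-substitute (inflateEntry c) h z a
  where
  h : ∀ e → proj₂ e ≢ neg → All (λ e → proj₂ e ≢ neg) (inflateEntry c e)
  h (y , t) nn with y ≡ᵇ c
  ... | false = nn ∷ []
  h (y , pos) nn | true = (λ ()) ∷ (λ ()) ∷ []
  h (y , neg) nn | true = ⊥-elim (nn refl)
  h (y , dot) nn | true = (λ ()) ∷ (λ ()) ∷ []

inflate-sortable : ∀ c → 1 ≤ c → ∀ k w → All Undotted w → Sortable k w → Sortable k (inflate c w)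
inflate-sortable c le k w df r = sortable-substitute (inflateEntry c) Undotted-flipClosed (inflateEntry-equivariant c) (λ z _ → inflate-identity c le z) k w df r

vals-map-flipEntry : ∀ xs → vals (map flipEntry xs) ≡ vals xs
vals-map-flipEntry [] = refl
vals-map-flipEntry (x ∷ xs) = cong (proj₁ x ∷_) (vals-map-flipEntry xs)

vals-revFlip : ∀ xs → vals (revFlip xs) ≡ reverse (vals xs)
vals-revFlip xs = trans (vals-map-flipEntry (reverse xs)) (reverse-map proj₁ xs)

vals-prefixRev : ∀ j w → vals (prefixRev j w) ↭ vals w
vals-prefixRev j w = begin
  vals (revFlip (take j w) ++ drop j w)          ≡⟨ map-++ proj₁ (revFlip (take j w)) (drop j w) ⟩
  vals (revFlip (take j w)) ++ vals (drop j w)   ≡⟨ cong (_++ vals (drop j w)) (vals-revFlip (take j w)) ⟩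
  reverse (vals (take j w)) ++ vals (drop j w)   ↭⟨ ++⁺ʳ (vals (drop j w)) (↭-reverse (vals (take j w))) ⟩
  vals (take j w) ++ vals (drop j w)             ≡⟨ sym (map-++ proj₁ (take j w) (drop j w)) ⟩
  vals (take j w ++ drop j w)                    ≡⟨ cong vals (take++drop≡id j w) ⟩
  vals w                                         ∎
  where open PermutationReasoning

vals-applyRevs : ∀ w js → vals (applyRevs w js) ↭ vals w
vals-applyRevs w [] = ↭-refl
vals-applyRevs w (j ∷ js) = ↭-trans (vals-applyRevs (prefixRev j w) js) (vals-prefixRev j w)

sortable⇒peg : ∀ k w → Sortable k w → IsPeg w
sortable⇒peg k w (js , _ , (sorted , _)) = ↭-trans (↭-sym (vals-applyRevs w js))
  (↭-reflexive (trans sorted (cong oneTo (length-applyRevs w js))))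

Unique-resp-↭ : ∀ {xs ys : List ℕ} → xs ↭ ys → Unique xs → Unique ys
Unique-resp-↭ ↭.refl u = u
Unique-resp-↭ (↭.prep x p) (a ∷ u) = All-resp-↭ p a ∷ Unique-resp-↭ p u
Unique-resp-↭ (↭.swap x y p) ((x≢y ∷ a) ∷ (b ∷ u)) =
  ((λ e → x≢y (sym e)) ∷ All-resp-↭ p b) ∷ (All-resp-↭ p a ∷ Unique-resp-↭ p u)
Unique-resp-↭ (↭.trans p q) u = Unique-resp-↭ q (Unique-resp-↭ p u)

peg⇒unique : ∀ w → IsPeg w → Unique (vals w)
peg⇒unique w p = Unique-resp-↭ (↭-sym p) (UP.map⁺ suc-injective (UP.upTo⁺ (length w)))

∈-consecutive⇒≥ : ∀ {x} m n → x ∈ consecutive m n → m ≤ x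
∈-consecutive⇒≥ m (suc n) (here refl) = ≤-refl
∈-consecutive⇒≥ m (suc n) (there x∈) = <⇒≤ (∈-consecutive⇒≥ (suc m) n x∈)

peg⇒positive : ∀ w → IsPeg w → All (λ e → 1 ≤ proj₁ e) w
peg⇒positive w p = AllP.map⁻ (All-resp-↭ (↭-sym p) (All.tabulate positive))
  where
  positive : ∀ {x} → x ∈ oneTo (length w) → 1 ≤ x
  positive x∈ = ∈-consecutive⇒≥ 1 (length w) (subst (_ ∈_) (oneTo≡consecutive (length w)) x∈)

unique-split : ∀ α (e : Entry) β → Unique (vals (α ++ e ∷ β)) →
  All (λ f → proj₁ f ≢ proj₁ e) α × All (λ f → proj₁ f ≢ proj₁ e) β
unique-split [] e β (e∉β ∷ _) = [] , AllP.map⁻ (All.tabulate (λ x∈ x≡ → All.lookup e∉β x∈ (sym x≡)))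
unique-split (x ∷ α) e β (x∉ ∷ u) =
  let (α-avoids , β-avoids) = unique-split α e β u in
  All.lookup x∉ (∈-map⁺ proj₁ (∈-++⁺ʳ α (here refl))) ∷ α-avoids , β-avoids

-- Clean compact words

Unlinked : Entry → Entry → Set
Unlinked e f = ¬ IncLink e f × ¬ DecLink e f

cc-∷ : ∀ x xs → CleanCompact xs → (∀ y ys → xs ≡ y ∷ ys → Unlinked x y) → CleanCompact (x ∷ xs)
cc-∷ x [] c h = cc-one x
cc-∷ x (y ∷ ys) c h = cc-cons x y ys (proj₁ (h y ys refl)) (proj₂ (h y ys refl)) c

cc-head : ∀ x y xs → CleanCompact (x ∷ y ∷ xs) → Unlinked x y
cc-head x y xs (cc-cons .x .y .xs ¬inc ¬dec _) = ¬inc , ¬dec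

cc-tail : ∀ x xs → CleanCompact (x ∷ xs) → CleanCompact xs
cc-tail x [] c = cc-nil
cc-tail x (y ∷ xs) (cc-cons .x .y .xs _ _ c) = c

cc-++ : ∀ xs e ys → CleanCompact (xs ++ [ e ]) → CleanCompact (e ∷ ys) → CleanCompact (xs ++ e ∷ ys)
cc-++ [] e ys c d = d
cc-++ (x ∷ []) e ys (cc-cons .x .e .[] ¬inc ¬dec _) d = cc-cons x e ys ¬inc ¬dec d
cc-++ (x ∷ x' ∷ xs) e ys (cc-cons .x .x' .(xs ++ [ e ]) ¬inc ¬dec c) d =
  cc-cons x x' (xs ++ e ∷ ys) ¬inc ¬dec (cc-++ (x' ∷ xs) e ys c d)

cc-++ˡ : ∀ xs ys → CleanCompact (xs ++ ys) → CleanCompact xs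
cc-++ˡ [] ys c = cc-nil
cc-++ˡ (x ∷ []) ys c = cc-one x
cc-++ˡ (x ∷ x' ∷ xs) ys (cc-cons .x .x' .(xs ++ ys) ¬inc ¬dec c) = cc-cons x x' xs ¬inc ¬dec (cc-++ˡ (x' ∷ xs) ys c)

cc-++ʳ : ∀ xs ys → CleanCompact (xs ++ ys) → CleanCompact ys
cc-++ʳ [] ys c = c
cc-++ʳ (x ∷ xs) ys c = cc-++ʳ xs ys (cc-tail x (xs ++ ys) c)

cc-∷ʳ : ∀ zs a b → CleanCompact (zs ++ [ a ]) → Unlinked a b → CleanCompact (zs ++ a ∷ b ∷ [])
cc-∷ʳ zs a b c (¬inc , ¬dec) = cc-++ zs a [ b ] c (cc-cons a b [] ¬inc ¬dec (cc-one b))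

flip≢neg⇒≢pos : ∀ {s} → flip s ≢ neg → s ≢ pos
flip≢neg⇒≢pos {pos} h = λ _ → h refl
flip≢neg⇒≢pos {neg} h = λ ()
flip≢neg⇒≢pos {dot} h = λ ()

flip≢pos⇒≢neg : ∀ {s} → flip s ≢ pos → s ≢ neg
flip≢pos⇒≢neg {pos} h = λ ()
flip≢pos⇒≢neg {neg} h = λ _ → h refl
flip≢pos⇒≢neg {dot} h = λ ()

unlinked-flip : ∀ e f → Unlinked e f → Unlinked (flipEntry f) (flipEntry e)
unlinked-flip (a , s) (b , t) (¬inc , ¬dec) =
  (λ { (q , u , v) → ¬dec (q , flip≢neg⇒≢pos v , flip≢neg⇒≢pos u) }) ,
  (λ { (q , u , v) → ¬inc (q , flip≢pos⇒≢neg v , flip≢pos⇒≢neg u) })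

cc-revFlip : ∀ xs → CleanCompact xs → CleanCompact (revFlip xs)
cc-revFlip [] c = cc-nil
cc-revFlip (x ∷ []) c = cc-one (flipEntry x)
cc-revFlip (x ∷ y ∷ xs) (cc-cons .x .y .xs ¬inc ¬dec c) =
  subst CleanCompact (sym unfold)
    (cc-∷ʳ (revFlip xs) (flipEntry y) (flipEntry x) (subst CleanCompact (revFlip-∷ y xs) (cc-revFlip (y ∷ xs) c))
           (unlinked-flip x y (¬inc , ¬dec)))
  where
  unfold : revFlip (x ∷ y ∷ xs) ≡ revFlip xs ++ flipEntry y ∷ flipEntry x ∷ []
  unfold = trans (revFlip-∷ x (y ∷ xs))
                 (trans (cong (_++ [ flipEntry x ]) (revFlip-∷ y xs)) (++-assoc (revFlip xs) [ flipEntry y ] [ flipEntry x ]))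

cc-map : ∀ (g : Entry → Entry) (P : Entry → Set) → (∀ e f → P e → P f → Unlinked e f → Unlinked (g e) (g f)) →
  ∀ xs → All P xs → CleanCompact xs → CleanCompact (map g xs)
cc-map g P h [] _ c = cc-nil
cc-map g P h (x ∷ []) _ c = cc-one (g x)
cc-map g P h (x ∷ y ∷ xs) (px ∷ py ∷ a) (cc-cons .x .y .xs ¬inc ¬dec c) =
  let (¬inc' , ¬dec') = h x y px py (¬inc , ¬dec) in
  cc-cons (g x) (g y) (map g xs) ¬inc' ¬dec' (cc-map g P h (y ∷ xs) (py ∷ a) c)

raiseEntry : ℕ → Entry → Entry
raiseEntry v e = raise v (proj₁ e) , proj₂ e

raise-reflects-suc : ∀ v a b → raise v b ≡ suc (raise v a) → b ≡ suc a
raise-reflects-suc v a b e with a ≤? v | b ≤? v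
... | yes a≤v | yes b≤v rewrite raise-≤ a≤v | raise-≤ b≤v = e
... | yes a≤v | no b≰v rewrite raise-≤ a≤v | raise-> (≰⇒> b≰v) = ⊥-elim (b≰v (subst (_≤ v) (sym (suc-injective e)) a≤v))
... | no a≰v | yes b≤v rewrite raise-> (≰⇒> a≰v) | raise-≤ b≤v =
  ⊥-elim (1+n≰n (≤-trans (n≤1+n (suc a)) (≤-trans (subst (_≤ v) e b≤v) (<⇒≤ (≰⇒> a≰v)))))
... | no a≰v | no b≰v rewrite raise-> (≰⇒> a≰v) | raise-> (≰⇒> b≰v) = suc-injective e

unlinked-raise : ∀ v e f → Unlinked e f → Unlinked (raiseEntry v e) (raiseEntry v f)
unlinked-raise v (a , s) (b , t) (¬inc , ¬dec) =
  (λ { (q , u , w) → ¬inc (raise-reflects-suc v a b q , u , w) }) ,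
  (λ { (q , u , w) → ¬dec (raise-reflects-suc v b a q , u , w) })

cc-raise : ∀ v xs → CleanCompact xs → CleanCompact (map (raiseEntry v) xs)
cc-raise v xs = cc-map (raiseEntry v) (λ _ → ⊤) (λ e f _ _ → unlinked-raise v e f) xs (All.universal (λ _ → tt) xs)

deleteAll : List ℕ → Word → Word
deleteAll [] w = w
deleteAll (v ∷ vs) w = deleteAll vs (delete v w)

deleteAll-++-values : ∀ us vs w → deleteAll (us ++ vs) w ≡ deleteAll vs (deleteAll us w)
deleteAll-++-values [] vs w = refl
deleteAll-++-values (u ∷ us) vs w = deleteAll-++-values us vs (delete u w)

-- The sets G_k, indexed from G_0 = {1⁺} so that the step rule is the only way to extend them.

data Gen : ℕ → Word → Set where
  gen-base : Gen 0 ((1 , pos) ∷ [])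
  gen-step : ∀ {k p q} → Gen k p → Step p q → Gen (suc k) q

G⇒Gen : ∀ {k p} → G k p → Gen k p
G⇒Gen g1 = gen-step gen-base (step+ [] 1 [])
G⇒Gen (gs g s) = gen-step (G⇒Gen g) s

step-from-base : ∀ {p q} → p ≡ (1 , pos) ∷ [] → Step p q → q ≡ (1 , neg) ∷ (2 , pos) ∷ []
step-from-base e (step+ [] v []) with e
... | refl = refl
step-from-base e (step+ [] v (_ ∷ _)) with e
... | ()
step-from-base e (step+ (_ ∷ []) v β) with e
... | ()
step-from-base e (step+ (_ ∷ _ ∷ _) v β) with e
... | ()
step-from-base e (step- [] v β) with e
... | ()
step-from-base e (step- (_ ∷ []) v β) with e
... | ()
step-from-base e (step- (_ ∷ _ ∷ _) v β) with e
... | ()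

Gen⇒G : ∀ {k p} → Gen (suc k) p → G (suc k) p
Gen⇒G (gen-step gen-base s) with step-from-base refl s
... | refl = g1
Gen⇒G (gen-step (gen-step g s') s) = gs (Gen⇒G (gen-step g s')) s

All-middle : ∀ {P : Entry → Set} α e β → All P (α ++ e ∷ β) → P e
All-middle α e β a = All.lookup a (∈-++⁺ʳ α (here refl))

Avoids : ℕ → Word → Set
Avoids v = All (λ f → proj₁ f ≢ v)

raise-self : ∀ v → raise v v ≡ v
raise-self v = raise-≤ ≤-refl

raise-pred-self : ∀ v → 1 ≤ v → raise (pred v) v ≡ suc v
raise-pred-self (suc v) _ = raise-> ≤-refl

raise-pred : ∀ v y → 1 ≤ v → y ≢ v → raise (pred v) y ≡ raise v y
raise-pred (suc v) y _ y≢ with y ≤? v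
... | yes y≤v rewrite raise-≤ y≤v | raise-≤ (m≤n⇒m≤1+n y≤v) = refl
... | no y≰v rewrite raise-> (≰⇒> y≰v) | raise-> (≤∧≢⇒< (≰⇒> y≰v) (λ e → y≢ (sym e))) = refl

raise-≡-self : ∀ v y → raise v y ≡ v → y ≡ v
raise-≡-self v y e with y ≤? v
... | yes y≤v rewrite raise-≤ y≤v = e
... | no y≰v rewrite raise-> (≰⇒> y≰v) = ⊥-elim (<-asym (≰⇒> y≰v) (subst (y <_) e (n<1+n y)))

raise-≡-suc : ∀ v y → raise v y ≡ suc v → y ≡ v
raise-≡-suc v y e with y ≤? v
... | yes y≤v rewrite raise-≤ y≤v = ⊥-elim (1+n≰n (subst (_≤ v) e y≤v))
... | no y≰v rewrite raise-> (≰⇒> y≰v) = suc-injective e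

raise-pred-avoiding : ∀ v β → 1 ≤ v → Avoids v β → map (raiseEntry (pred v)) β ≡ bump v β
raise-pred-avoiding v [] _ [] = refl
raise-pred-avoiding v ((y , t) ∷ β) v≥1 (y≢ ∷ a) = cong₂ _∷_ (cong (_, t) (raise-pred v y v≥1 y≢)) (raise-pred-avoiding v β v≥1 a)

inflate-avoiding : ∀ v α → Avoids v α → inflate v α ≡ bump v α
inflate-avoiding v [] [] = refl
inflate-avoiding v ((y , t) ∷ α) (y≢ ∷ a) rewrite inflateEntry-other {v} {y} t y≢ = cong (_ ∷_) (inflate-avoiding v α a)

length-bump : ∀ v xs → length (bump v xs) ≡ length xs
length-bump v xs = length-map (raiseEntry v) xs

-- The two entries of strip x s, in order: the step rule puts the first one, flipped, in front.
stripFirst stripSecond : ℕ → Sign → Entry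
stripFirst x neg = (suc x , neg)
stripFirst x s = (x , s)
stripSecond x neg = (x , neg)
stripSecond x s = (suc x , s)

strip≡ : ∀ x s → strip x s ≡ stripFirst x s ∷ stripSecond x s ∷ []
strip≡ x pos = refl
strip≡ x neg = refl
strip≡ x dot = refl

inflate-split : ∀ α x s β → Avoids x α → Avoids x β →
  inflate x (α ++ (x , s) ∷ β) ≡ bump x α ++ stripFirst x s ∷ stripSecond x s ∷ bump x β
inflate-split α x s β α-avoids β-avoids = begin
  inflate x (α ++ (x , s) ∷ β)                                   ≡⟨ substitute-++ (inflateEntry x) α ((x , s) ∷ β) ⟩
  inflate x α ++ inflateEntry x (x , s) ++ inflate x β            ≡⟨ cong₂ _++_ (inflate-avoiding x α α-avoids)
                                                                      (cong₂ _++_ (inflateEntry-self x s) (inflate-avoiding x β β-avoids)) ⟩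
  bump x α ++ strip x s ++ bump x β                              ≡⟨ cong (λ z → bump x α ++ z ++ bump x β) (strip≡ x s) ⟩
  bump x α ++ stripFirst x s ∷ stripSecond x s ∷ bump x β        ∎
  where open ≡-Reasoning

-- The step rule, uniformly in the decoration s ∈ {+, -}.
stepWord : Word → ℕ → Sign → Word → Word
stepWord α x s β = revFlip (bump x α ++ [ stripFirst x s ]) ++ stripSecond x s ∷ bump x β

stepWord-step : ∀ α x s β → s ≢ dot → Step (α ++ (x , s) ∷ β) (stepWord α x s β)
stepWord-step α x pos β _ = subst (Step _) (cong (_++ _) (sym (revFlip-∷ʳ (bump x α) (x , pos)))) (step+ α x β)
stepWord-step α x neg β _ = subst (Step _) (cong (_++ _) (sym (revFlip-∷ʳ (bump x α) (suc x , neg)))) (step- α x β)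
stepWord-step α x dot β undotted = ⊥-elim (undotted refl)

data StepView : Word → Word → Set where
  step-view : ∀ α x s β → s ≢ dot → StepView (α ++ (x , s) ∷ β) (stepWord α x s β)

Step⇒StepView : ∀ {p q} → Step p q → StepView p q
Step⇒StepView (step+ α x β) =
  subst (StepView _) (cong (_++ _) (revFlip-∷ʳ (bump x α) (x , pos))) (step-view α x pos β (λ ()))
Step⇒StepView (step- α x β) =
  subst (StepView _) (cong (_++ _) (revFlip-∷ʳ (bump x α) (suc x , neg))) (step-view α x neg β (λ ()))

length-stepWord : ∀ α x s β → length (stepWord α x s β) ≡ suc (length (α ++ (x , s) ∷ β))
length-stepWord α x s β = begin
  length (revFlip (bump x α ++ [ stripFirst x s ]) ++ stripSecond x s ∷ bump x β)      ≡⟨ length-++ (revFlip (bump x α ++ [ stripFirst x s ])) ⟩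
  length (revFlip (bump x α ++ [ stripFirst x s ])) + suc (length (bump x β))          ≡⟨ cong₂ (λ m n → m + suc n)
                                                                                           (length-revFlip (bump x α ++ [ stripFirst x s ])) (length-bump x β) ⟩
  length (bump x α ++ [ stripFirst x s ]) + suc (length β)                             ≡⟨ cong (_+ suc (length β))
                                                                                           (trans (length-++ (bump x α)) (cong (_+ 1) (length-bump x α))) ⟩
  (length α + 1) + suc (length β)                                                      ≡⟨ cong (_+ suc (length β)) (+-comm (length α) 1) ⟩
  suc (length α + suc (length β))                                                      ≡⟨ cong suc (sym (length-++ α)) ⟩
  suc (length (α ++ (x , s) ∷ β))                                                      ∎
  where open ≡-Reasoning

prefixRev-stepWord : ∀ α x s β → Avoids x α → Avoids x β →
  prefixRev (suc (length α)) (stepWord α x s β) ≡ inflate x (α ++ (x , s) ∷ β)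
prefixRev-stepWord α x s β α-avoids β-avoids = begin
  prefixRev (suc (length α)) (revFlip A ++ B)               ≡⟨ cong (λ n → prefixRev n (revFlip A ++ B)) length-A ⟩
  prefixRev (length (revFlip A)) (revFlip A ++ B)           ≡⟨ prefixRev-++ (revFlip A) B ⟩
  revFlip (revFlip A) ++ B                                  ≡⟨ cong (_++ B) (revFlip-involutive A) ⟩
  (bump x α ++ [ stripFirst x s ]) ++ B                     ≡⟨ ++-assoc (bump x α) _ B ⟩
  bump x α ++ stripFirst x s ∷ stripSecond x s ∷ bump x β   ≡⟨ sym (inflate-split α x s β α-avoids β-avoids) ⟩
  inflate x (α ++ (x , s) ∷ β)                              ∎
  where
  open ≡-Reasoning
  A = bump x α ++ [ stripFirst x s ]
  B = stripSecond x s ∷ bump x β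
  length-A : suc (length α) ≡ length (revFlip A)
  length-A = sym (trans (length-revFlip A) (trans (length-++ (bump x α)) (trans (cong (_+ 1) (length-bump x α)) (+-comm (length α) 1))))

stepWord-sortable : ∀ k α x s β → Avoids x α → Avoids x β → 1 ≤ x → All Undotted (α ++ (x , s) ∷ β) →
  Sortable k (α ++ (x , s) ∷ β) → Sortable (suc k) (stepWord α x s β)
stepWord-sortable k α x s β α-avoids β-avoids x≥1 undotted sortable
  with inflate-sortable x x≥1 k (α ++ (x , s) ∷ β) undotted sortable
... | (js , l , i) = suc (length α) ∷ js , s≤s l ,
  subst (λ z → IsIdentityPeg (applyRevs z js)) (sym (prefixRev-stepWord α x s β α-avoids β-avoids)) i

stepWord-undotted : ∀ α x s β → s ≢ dot → All Undotted (α ++ (x , s) ∷ β) → All Undotted (stepWord α x s β)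
stepWord-undotted α x s β s≢dot undotted =
  AllP.++⁺ (All-revFlip Undotted-flipClosed _ (AllP.++⁺ (AllP.map⁺ (AllP.++⁻ˡ α undotted)) (first s s≢dot ∷ [])))
           (second s s≢dot ∷ AllP.map⁺ (AllP.++⁻ʳ ((x , s) ∷ []) (AllP.++⁻ʳ α undotted)))
  where
  first : ∀ s → s ≢ dot → Undotted (stripFirst x s)
  first pos _ = λ ()
  first neg _ = λ ()
  first dot s≢dot = s≢dot
  second : ∀ s → s ≢ dot → Undotted (stripSecond x s)
  second pos _ = λ ()
  second neg _ = λ ()
  second dot s≢dot = s≢dot

cc-stepWord-left : ∀ α x s → s ≢ dot → 1 ≤ x → Avoids x α → CleanCompact (α ++ [ (x , s) ]) →
  CleanCompact (revFlip (bump x α ++ [ stripFirst x s ]) ++ [ stripSecond x s ])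
cc-stepWord-left α x s s≢dot x≥1 α-avoids c =
  subst CleanCompact unfold (cc-revFlip _ (cc-∷ _ _ (raised-cc s s≢dot c) (head-unlinked s s≢dot α α-avoids)))
  where
  unfold : revFlip (flipEntry (stripSecond x s) ∷ bump x α ++ [ stripFirst x s ])
         ≡ revFlip (bump x α ++ [ stripFirst x s ]) ++ [ stripSecond x s ]
  unfold = trans (revFlip-∷ (flipEntry (stripSecond x s)) (bump x α ++ [ stripFirst x s ])) (cong (λ e → revFlip (bump x α ++ [ stripFirst x s ]) ++ [ e ]) (flipEntry-involutive (stripSecond x s)))
  raised-cc : ∀ s → s ≢ dot → CleanCompact (α ++ [ (x , s) ]) → CleanCompact (bump x α ++ [ stripFirst x s ])
  raised-cc pos _ c = subst CleanCompact (trans (map-++ (raiseEntry x) α _) (cong (λ y → bump x α ++ [ (y , pos) ]) (raise-self x)))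
    (cc-raise x _ c)
  raised-cc neg _ c = subst CleanCompact
    (trans (map-++ (raiseEntry (pred x)) α _) (cong₂ (λ l y → l ++ [ (y , neg) ]) (raise-pred-avoiding x α x≥1 α-avoids) (raise-pred-self x x≥1)))
    (cc-raise (pred x) _ c)
  raised-cc dot s≢dot _ = ⊥-elim (s≢dot refl)
  head-unlinked : ∀ s → s ≢ dot → ∀ α → Avoids x α → ∀ y ys →
    bump x α ++ [ stripFirst x s ] ≡ y ∷ ys → Unlinked (flipEntry (stripSecond x s)) y
  head-unlinked pos _ [] _ _ _ refl = (λ { (_ , n , _) → n refl }) , (λ { (_ , _ , n) → n refl })
  head-unlinked pos _ ((z , t) ∷ _) (z≢ ∷ _) _ _ refl =
    (λ { (_ , n , _) → n refl }) , (λ { (q , _ , _) → z≢ (raise-≡-self x z (sym (suc-injective q))) })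
  head-unlinked neg _ [] _ _ _ refl = (λ { (_ , _ , n) → n refl }) , (λ { (_ , n , _) → n refl })
  head-unlinked neg _ ((z , t) ∷ _) (z≢ ∷ _) _ _ refl =
    (λ { (q , _ , _) → z≢ (raise-≡-suc x z q) }) , (λ { (_ , n , _) → n refl })
  head-unlinked dot s≢dot _ _ _ _ _ = ⊥-elim (s≢dot refl)

cc-stepWord-right : ∀ x s β → s ≢ dot → 1 ≤ x → Avoids x β → CleanCompact ((x , s) ∷ β) →
  CleanCompact (stripSecond x s ∷ bump x β)
cc-stepWord-right x pos β _ x≥1 β-avoids c =
  subst CleanCompact (cong₂ _∷_ (cong (_, pos) (raise-pred-self x x≥1)) (raise-pred-avoiding x β x≥1 β-avoids)) (cc-raise (pred x) _ c)
cc-stepWord-right x neg β _ _ _ c = subst CleanCompact (cong (λ y → (y , neg) ∷ bump x β) (raise-self x)) (cc-raise x _ c)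
cc-stepWord-right x dot β s≢dot _ _ _ = ⊥-elim (s≢dot refl)

stepWord-cc : ∀ α x s β → s ≢ dot → 1 ≤ x → Avoids x α → Avoids x β → CleanCompact (α ++ (x , s) ∷ β) →
  CleanCompact (stepWord α x s β)
stepWord-cc α x s β s≢dot x≥1 α-avoids β-avoids c =
  cc-++ _ (stripSecond x s) (bump x β)
    (cc-stepWord-left α x s s≢dot x≥1 α-avoids (cc-++ˡ (α ++ [ (x , s) ]) β (subst CleanCompact (sym (++-assoc α [ (x , s) ] β)) c)))
    (cc-stepWord-right x s β s≢dot x≥1 β-avoids (cc-++ʳ α _ c))

GenInvariant : ℕ → Word → Set
GenInvariant k p = Sortable k p × All Undotted p × CleanCompact p × (length p ≡ suc k)

gen-invariant : ∀ {k p} → Gen k p → GenInvariant k p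
gen-invariant gen-base = ([] , z≤n , refl , (λ ()) ∷ []) , (λ ()) ∷ [] , cc-one _ , refl
gen-invariant (gen-step {k} g step) with Step⇒StepView step | gen-invariant g
... | step-view α x s β s≢dot | (sortable , undotted , c , len) =
  stepWord-sortable k α x s β α-avoids β-avoids x≥1 undotted sortable ,
  stepWord-undotted α x s β s≢dot undotted ,
  stepWord-cc α x s β s≢dot x≥1 α-avoids β-avoids c ,
  trans (length-stepWord α x s β) (cong suc len)
  where
  peg = sortable⇒peg k _ sortable
  α-avoids = proj₁ (unique-split α (x , s) β (peg⇒unique _ peg))
  β-avoids = proj₂ (unique-split α (x , s) β (peg⇒unique _ peg))
  x≥1 = All-middle α (x , s) β (peg⇒positive _ peg)

-- Deletions and inflations commute

substitute-singleton : ∀ f e → substitute f (e ∷ []) ≡ f e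
substitute-singleton f e = ++-identityʳ (f e)

deleteAll-++ : ∀ W xs ys → deleteAll W (xs ++ ys) ≡ deleteAll W xs ++ deleteAll W ys
deleteAll-++ [] xs ys = refl
deleteAll-++ (v ∷ W) xs ys = trans (cong (deleteAll W) (substitute-++ (deleteEntry v) xs ys)) (deleteAll-++ W (delete v xs) (delete v ys))

deleteAll-revFlip : ∀ W xs → deleteAll W (revFlip xs) ≡ revFlip (deleteAll W xs)
deleteAll-revFlip [] xs = refl
deleteAll-revFlip (v ∷ W) xs = trans (cong (deleteAll W) (substitute-revFlip (deleteEntry v) xs (All.universal (deleteEntry-equivariant v) xs))) (deleteAll-revFlip W (delete v xs))

deleteAll-[] : ∀ W → deleteAll W [] ≡ []
deleteAll-[] [] = refl
deleteAll-[] (v ∷ W) = deleteAll-[] W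

delete-singleton : ∀ v x s → (delete v ((x , s) ∷ []) ≡ []) ⊎ (delete v ((x , s) ∷ []) ≡ (lower v x , s) ∷ [] × x ≢ v)
delete-singleton v x s with x ≟ v
... | yes refl rewrite deleteEntry-self x s = inj₁ refl
... | no ne rewrite deleteEntry-other {v} {x} s ne = inj₂ (refl , ne)

deleteAll-singleton : ∀ W x s → (deleteAll W ((x , s) ∷ []) ≡ []) ⊎ (∃ λ c → deleteAll W ((x , s) ∷ []) ≡ (c , s) ∷ [])
deleteAll-singleton [] x s = inj₂ (x , refl)
deleteAll-singleton (v ∷ W) x s with delete-singleton v x s
... | inj₁ e rewrite e = inj₁ (deleteAll-[] W)
... | inj₂ (e , _) rewrite e = deleteAll-singleton W (lower v x) s

∈-delete⁻ : ∀ v w e → e ∈ delete v w → ∃ λ x → ((x , proj₂ e) ∈ w) × (delete v ((x , proj₂ e) ∷ []) ≡ e ∷ [])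
∈-delete⁻ v ((y , t) ∷ w) e m with ∈-++⁻ (deleteEntry v (y , t)) m
... | inj₂ m' = let (x , a , b) = ∈-delete⁻ v w e m' in x , there a , b
... | inj₁ m' with y ≟ v
... | yes refl rewrite deleteEntry-self y t with m'
... | ()
∈-delete⁻ v ((y , t) ∷ w) e m | inj₁ m' | no ne with subst (e ∈_) (deleteEntry-other {v} {y} t ne) m'
... | here refl = y , here refl , trans (substitute-singleton (deleteEntry v) (y , t)) (deleteEntry-other t ne)

∈-deleteAll⁻ : ∀ W w e → e ∈ deleteAll W w → ∃ λ x → ((x , proj₂ e) ∈ w) × (deleteAll W ((x , proj₂ e) ∷ []) ≡ e ∷ [])
∈-deleteAll⁻ [] w e m = proj₁ e , m , refl
∈-deleteAll⁻ (v ∷ W) w e m with ∈-deleteAll⁻ W (delete v w) e m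
... | (x1 , m1 , e1) with ∈-delete⁻ v w (x1 , proj₂ e) m1
... | (x , m2 , e2) = x , m2 , trans (cong (deleteAll W) e2) e1

substitute-∘-cong : ∀ f g f' g' → (∀ e → substitute f (g e) ≡ substitute f' (g' e)) → ∀ w → substitute f (substitute g w) ≡ substitute f' (substitute g' w)
substitute-∘-cong f g f' g' h [] = refl
substitute-∘-cong f g f' g' h (e ∷ w) = trans (substitute-++ f (g e) (substitute g w)) (trans (cong₂ _++_ (h e) (substitute-∘-cong f g f' g' h w)) (sym (substitute-++ f' (g' e) (substitute g' w))))


suc-pred-pos : ∀ {x} → 0 < x → suc (pred x) ≡ x
suc-pred-pos 0<x = suc-pred _ {{>-nonZero 0<x}}

pred-mono-pos : ∀ {a b} → 0 < a → a < b → pred a < pred b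
pred-mono-pos 0<a = pred-mono-< {{>-nonZero 0<a}}

delete-strip-below : ∀ v x t → v < x → delete v (strip x t) ≡ strip (pred x) t
delete-strip-below v x t v<x = go t
  where
  v<sx = m<n⇒m<1+n v<x
  x≡ : x ≡ suc (pred x)
  x≡ = sym (suc-pred-pos (≤-trans (s≤s z≤n) v<x))
  go : ∀ t → delete v (strip x t) ≡ strip (pred x) t
  go pos rewrite deleteEntry-above {v} pos v<x | deleteEntry-above {v} pos v<sx = cong (λ z → (pred x , pos) ∷ (z , pos) ∷ []) x≡
  go neg rewrite deleteEntry-above {v} neg v<sx | deleteEntry-above {v} neg v<x = cong (λ z → (z , neg) ∷ (pred x , neg) ∷ []) x≡
  go dot rewrite deleteEntry-above {v} dot v<x | deleteEntry-above {v} dot v<sx = cong (λ z → (pred x , dot) ∷ (z , dot) ∷ []) x≡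

delete-strip-above : ∀ v x t → suc x < v → delete v (strip x t) ≡ strip x t
delete-strip-above v x t sx<v = go t
  where
  x<v = <-trans (n<1+n x) sx<v
  go : ∀ t → delete v (strip x t) ≡ strip x t
  go pos rewrite deleteEntry-below {v} pos x<v | deleteEntry-below {v} pos sx<v = refl
  go neg rewrite deleteEntry-below {v} neg sx<v | deleteEntry-below {v} neg x<v = refl
  go dot rewrite deleteEntry-below {v} dot x<v | deleteEntry-below {v} dot sx<v = refl
inflate-delete-other : ∀ v x c1 v' y t d1 b → y ≢ v → y ≢ x → lower v y ≡ d1 → d1 ≢ c1 → raise x y ≡ b → b ≢ v' → raise c1 d1 ≡ lower v' b →
  substitute (inflateEntry c1) (deleteEntry v (y , t)) ≡ substitute (deleteEntry v') (inflateEntry x (y , t))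
inflate-delete-other v x c1 v' y t d1 b n1 n2 e1 n3 e2 n4 e3
  rewrite deleteEntry-other {v} {y} t n1 | inflateEntry-other {x} {y} t n2 | e1 | e2 | inflateEntry-other {c1} {d1} t n3 | deleteEntry-other {v'} {b} t n4 | e3 = refl

inflate-delete-commute-entry : ∀ v x e → x ≢ v → substitute (inflateEntry (lower v x)) (deleteEntry v e) ≡ substitute (deleteEntry (raise x v)) (inflateEntry x e)
inflate-delete-commute-entry v x (y , t) xv with <-cmp v x
... | tri≈ _ e _ = ⊥-elim (xv (sym e))
... | tri< v<x _ _ rewrite lower-> v<x | raise-≤ (<⇒≤ v<x) = caseA
  where
  x>0 : 0 < x
  x>0 = ≤-trans (s≤s z≤n) v<x
  caseA : substitute (inflateEntry (pred x)) (deleteEntry v (y , t)) ≡ substitute (deleteEntry v) (inflateEntry x (y , t))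
  caseA with y ≟ v | y ≟ x
  ... | yes refl | _ rewrite deleteEntry-self y t | inflateEntry-other {x} {y} t (<⇒≢ v<x) | raise-≤ (<⇒≤ v<x) | deleteEntry-self y t = refl
  ... | no _ | yes refl rewrite deleteEntry-other {v} {y} t xv | lower-> v<x | inflateEntry-self (pred y) t | inflateEntry-self y t =
        trans (++-identityʳ _) (sym (delete-strip-below v y t v<x))
  ... | no yv | no yx with <-cmp y v | <-cmp y x
  ...   | tri≈ _ e _ | _ = ⊥-elim (yv e)
  ...   | _ | tri≈ _ e _ = ⊥-elim (yx e)
  ...   | tri< y<v _ _ | _ = inflate-delete-other v x (pred x) v y t y y yv yx (lower-≤ (<⇒≤ y<v))
          (<⇒≢ (≤-trans y<v (≤-pred (subst (suc v ≤_) (sym (suc-pred-pos x>0)) v<x))))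
          (raise-≤ (<⇒≤ (<-trans y<v v<x))) yv (trans (raise-≤ (≤-trans (<⇒≤ y<v) (≤-pred (subst (suc v ≤_) (sym (suc-pred-pos x>0)) v<x)))) (sym (lower-≤ (<⇒≤ y<v))))
  ...   | tri> _ _ v<y | tri< y<x _ _ = inflate-delete-other v x (pred x) v y t (pred y) y yv yx (lower-> v<y)
          (<⇒≢ (pred-mono-pos (≤-trans (s≤s z≤n) v<y) y<x)) (raise-≤ (<⇒≤ y<x)) yv
          (trans (raise-≤ (<⇒≤ (pred-mono-pos (≤-trans (s≤s z≤n) v<y) y<x))) (sym (lower-> v<y)))
  ...   | tri> _ _ v<y | tri> _ _ x<y = inflate-delete-other v x (pred x) v y t (pred y) (suc y) yv yx (lower-> v<y)
          (>⇒≢ (pred-mono-pos x>0 x<y)) (raise-> x<y) (>⇒≢ (m<n⇒m<1+n v<y))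
          (trans (raise-> (pred-mono-pos x>0 x<y)) (trans (suc-pred-pos (≤-trans (s≤s z≤n) x<y)) (sym (lower-> (m<n⇒m<1+n v<y)))))
... | tri> _ _ x<v rewrite lower-≤ (<⇒≤ x<v) | raise-> x<v = caseB
  where
  caseB : substitute (inflateEntry x) (deleteEntry v (y , t)) ≡ substitute (deleteEntry (suc v)) (inflateEntry x (y , t))
  caseB with y ≟ v | y ≟ x
  ... | yes refl | _ rewrite deleteEntry-self y t | inflateEntry-other {x} {y} t (>⇒≢ x<v) | raise-> x<v | deleteEntry-self (suc y) t = refl
  ... | no _ | yes refl rewrite deleteEntry-other {v} {y} t xv | lower-≤ (<⇒≤ x<v) | inflateEntry-self y t =
        trans (++-identityʳ _) (sym (delete-strip-above (suc v) y t (s≤s x<v)))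
  ... | no yv | no yx with <-cmp y v | <-cmp y x
  ...   | tri≈ _ e _ | _ = ⊥-elim (yv e)
  ...   | _ | tri≈ _ e _ = ⊥-elim (yx e)
  ...   | tri< y<v _ _ | tri< y<x _ _ = inflate-delete-other v x x (suc v) y t y y yv yx (lower-≤ (<⇒≤ y<v)) yx (raise-≤ (<⇒≤ y<x))
          (<⇒≢ (m<n⇒m<1+n y<v)) (trans (raise-≤ (<⇒≤ y<x)) (sym (lower-≤ (≤-trans (<⇒≤ y<v) (n≤1+n v)))))
  ...   | tri< y<v _ _ | tri> _ _ x<y = inflate-delete-other v x x (suc v) y t y (suc y) yv yx (lower-≤ (<⇒≤ y<v)) yx (raise-> x<y)
          (<⇒≢ (s≤s y<v)) (trans (raise-> x<y) (sym (lower-≤ (<⇒≤ (s≤s y<v)))))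
  ...   | tri> _ _ v<y | tri< y<x _ _ = ⊥-elim (<-asym (<-trans x<v v<y) y<x)
  ...   | tri> _ _ v<y | tri> _ _ x<y = inflate-delete-other v x x (suc v) y t (pred y) (suc y) yv yx (lower-> v<y)
          (>⇒≢ (≤-trans x<v (≤-pred (subst (suc v ≤_) (sym (suc-pred-pos (≤-trans (s≤s z≤n) v<y))) v<y))))
          (raise-> x<y) (>⇒≢ (s≤s v<y))
          (trans (raise-> (≤-trans x<v (≤-pred (subst (suc v ≤_) (sym (suc-pred-pos (≤-trans (s≤s z≤n) v<y))) v<y))))
            (trans (suc-pred-pos (≤-trans (s≤s z≤n) v<y)) (sym (lower-> (s≤s v<y)))))

inflate-delete-commute : ∀ v x s c1 → delete v ((x , s) ∷ []) ≡ (c1 , s) ∷ [] → ∀ w → inflate c1 (delete v w) ≡ delete (raise x v) (inflate x w)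
inflate-delete-commute v x s c1 h w with delete-singleton v x s
... | inj₁ e = ⊥-elim (nil≢ (trans (sym e) h))
  where
  nil≢ : [] ≢ (c1 , s) ∷ []
  nil≢ ()
... | inj₂ (e , ne) with trans (sym e) h
... | refl = substitute-∘-cong (inflateEntry (lower v x)) (deleteEntry v) (deleteEntry (raise x v)) (inflateEntry x) (λ e → inflate-delete-commute-entry v x e ne) w

inflate-deleteAll-commute : ∀ W x s c → deleteAll W ((x , s) ∷ []) ≡ (c , s) ∷ [] → ∃ λ W' → ∀ w → inflate c (deleteAll W w) ≡ deleteAll W' (inflate x w)
inflate-deleteAll-commute [] x s c refl = [] , λ w → refl
inflate-deleteAll-commute (v ∷ W) x s c h with delete-singleton v x s
... | inj₁ e rewrite e | deleteAll-[] W = ⊥-elim (nil≢ h)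
  where
  nil≢ : [] ≢ (c , s) ∷ []
  nil≢ ()
... | inj₂ (e , ne) rewrite e with inflate-deleteAll-commute W (lower v x) s c h
... | (W0 , f) = raise x v ∷ W0 , λ w → trans (f (delete v w)) (cong (deleteAll W0) (inflate-delete-commute v x s (lower v x) (trans (substitute-singleton (deleteEntry v) (x , s)) (deleteEntry-other s ne)) w))

deleteAll-stripFirst : ∀ W' x c s → deleteAll W' (strip x s) ≡ strip c s → deleteAll W' (stripFirst x s ∷ []) ≡ stripFirst c s ∷ []
deleteAll-stripFirst W' x c s h with deleteAll-singleton W' (proj₁ (stripFirst x s)) (proj₂ (stripFirst x s)) | deleteAll-singleton W' (proj₁ (stripSecond x s)) (proj₂ (stripSecond x s))
... | r1 | r2 = go r1 r2 (trans (sym (trans (cong (deleteAll W') (strip≡ x s)) (deleteAll-++ W' (stripFirst x s ∷ []) (stripSecond x s ∷ [])))) (trans h (strip≡ c s)))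
  where
  go : ∀ {A B} → (A ≡ [] ⊎ ∃ λ c → A ≡ (c , proj₂ (stripFirst x s)) ∷ []) → (B ≡ [] ⊎ ∃ λ c → B ≡ (c , proj₂ (stripSecond x s)) ∷ []) →
       A ++ B ≡ stripFirst c s ∷ stripSecond c s ∷ [] → A ≡ stripFirst c s ∷ []
  go (inj₁ refl) (inj₁ refl) ()
  go (inj₁ refl) (inj₂ (_ , refl)) ()
  go (inj₂ (_ , refl)) (inj₁ refl) ()
  go (inj₂ (_ , refl)) (inj₂ (_ , refl)) e = cong (_∷ []) (proj₁ (∷-injective e))

inflate-singleton-self : ∀ c s → inflate c ((c , s) ∷ []) ≡ strip c s
inflate-singleton-self c s = trans (substitute-singleton (inflateEntry c) (c , s)) (inflateEntry-self c s)

inflate-deleteAll-image : ∀ W x s c → deleteAll W ((x , s) ∷ []) ≡ (c , s) ∷ [] →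
  ∃ λ W' → (∀ w → inflate c (deleteAll W w) ≡ deleteAll W' (inflate x w)) × (deleteAll W' (stripFirst x s ∷ []) ≡ stripFirst c s ∷ [])
inflate-deleteAll-image W x s c h with inflate-deleteAll-commute W x s c h
... | (W' , f) = W' , f , deleteAll-stripFirst W' x c s (trans (sym (trans (f ((x , s) ∷ [])) (cong (deleteAll W') (inflate-singleton-self x s)))) (trans (cong (inflate c) h) (inflate-singleton-self c s)))

delete-inflate-inverse : ∀ c s → s ≢ dot → ∀ w → All (λ f → proj₁ f ≡ c → proj₂ f ≡ s) w →
  delete (proj₁ (stripSecond c s)) (inflate c w) ≡ w
delete-inflate-inverse c s nd [] [] = refl
delete-inflate-inverse c s nd ((y , t) ∷ w) (h ∷ a) =
  trans (substitute-++ (deleteEntry (proj₁ (stripSecond c s))) (inflateEntry c (y , t)) (inflate c w))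
        (cong₂ _++_ (ent y t h) (delete-inflate-inverse c s nd w a))
  where
  ent : ∀ y t → (y ≡ c → t ≡ s) → delete (proj₁ (stripSecond c s)) (inflateEntry c (y , t)) ≡ (y , t) ∷ []
  ent y t h with y ≟ c
  ent y t h | yes refl with h refl
  ... | refl rewrite inflateEntry-self y t = go t nd
    where
    go : ∀ t → t ≢ dot → delete (proj₁ (stripSecond y t)) (strip y t) ≡ (y , t) ∷ []
    go pos _ rewrite deleteEntry-other {suc y} {y} pos (<⇒≢ (n<1+n y)) | lower-≤ (n≤1+n y) | deleteEntry-self (suc y) pos = refl
    go neg _ rewrite deleteEntry-other {y} {suc y} neg (>⇒≢ (n<1+n y)) | lower-> (n<1+n y) | deleteEntry-self y neg = refl
    go dot n = ⊥-elim (n refl)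
  ent y t h | no ne rewrite inflateEntry-other {c} {y} t ne = go s nd
    where
    go : ∀ s → s ≢ dot → delete (proj₁ (stripSecond c s)) ((raise c y , t) ∷ []) ≡ (y , t) ∷ []
    go pos _ with <-cmp y c
    ... | tri≈ _ e _ = ⊥-elim (ne e)
    ... | tri< y<c _ _ rewrite raise-≤ (<⇒≤ y<c) | deleteEntry-other {suc c} {y} t (<⇒≢ (m<n⇒m<1+n y<c)) | lower-≤ (≤-trans (<⇒≤ y<c) (n≤1+n c)) = refl
    ... | tri> _ _ c<y rewrite raise-> c<y | deleteEntry-other {suc c} {suc y} t (>⇒≢ (s≤s c<y)) | lower-> (s≤s c<y) = refl
    go neg _ with <-cmp y c
    ... | tri≈ _ e _ = ⊥-elim (ne e)
    ... | tri< y<c _ _ rewrite raise-≤ (<⇒≤ y<c) | deleteEntry-other {c} {y} t ne | lower-≤ (<⇒≤ y<c) = refl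
    ... | tri> _ _ c<y rewrite raise-> c<y | deleteEntry-other {c} {suc y} t (>⇒≢ (m<n⇒m<1+n c<y)) | lower-> (m<n⇒m<1+n c<y) = refl
    go dot n = ⊥-elim (n refl)

Avoids₂ : ℕ → ℕ → Word → Set
Avoids₂ a b = All (λ f → proj₁ f ≢ a × proj₁ f ≢ b)

inflate-delete-avoiding : ∀ c b a1 a2 → (∀ y t → y ≢ a1 → y ≢ a2 → inflate c (deleteEntry b (y , t)) ≡ (y , t) ∷ []) → ∀ Z → Avoids₂ a1 a2 Z → inflate c (delete b Z) ≡ Z
inflate-delete-avoiding c b a1 a2 h [] [] = refl
inflate-delete-avoiding c b a1 a2 h ((y , t) ∷ Z) ((n1 , n2) ∷ a) = trans (substitute-++ (inflateEntry c) (deleteEntry b (y , t)) (delete b Z)) (cong₂ _++_ (h y t n1 n2) (inflate-delete-avoiding c b a1 a2 h Z a))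

inflate-delete-around : ∀ c b a1 a2 X0 p Y0 → Avoids₂ a1 a2 X0 → Avoids₂ a1 a2 Y0 →
  (∀ y t → y ≢ a1 → y ≢ a2 → inflate c (deleteEntry b (y , t)) ≡ (y , t) ∷ []) →
  inflate c (delete b p) ≡ p →
  inflate c (delete b (X0 ++ p ++ Y0)) ≡ X0 ++ p ++ Y0
inflate-delete-around c b q1 q2 X0 p Y0 a1 a2 h hp =
  trans (cong (inflate c) (trans (substitute-++ (deleteEntry b) X0 (p ++ Y0)) (cong (delete b X0 ++_) (substitute-++ (deleteEntry b) p Y0))))
  (trans (substitute-++ (inflateEntry c) (delete b X0) _) (cong₂ _++_ (inflate-delete-avoiding c b q1 q2 h X0 a1)
    (trans (substitute-++ (inflateEntry c) (delete b p) (delete b Y0)) (cong₂ _++_ hp (inflate-delete-avoiding c b q1 q2 h Y0 a2)))))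

inflate-delete-incStrip : ∀ a X0 Y0 → Avoids₂ a (suc a) X0 → Avoids₂ a (suc a) Y0 →
  inflate a (delete (suc a) (X0 ++ ((a , pos) ∷ (suc a , pos) ∷ []) ++ Y0)) ≡ X0 ++ ((a , pos) ∷ (suc a , pos) ∷ []) ++ Y0
inflate-delete-incStrip a X0 Y0 a1 a2 = inflate-delete-around a (suc a) a (suc a) X0 _ Y0 a1 a2 h hp
  where
  hp : inflate a (delete (suc a) ((a , pos) ∷ (suc a , pos) ∷ [])) ≡ (a , pos) ∷ (suc a , pos) ∷ []
  hp rewrite deleteEntry-other {suc a} {a} pos (<⇒≢ (n<1+n a)) | lower-≤ (n≤1+n a) | deleteEntry-self (suc a) pos | inflateEntry-self a pos = refl
  h : ∀ y t → y ≢ a → y ≢ suc a → inflate a (deleteEntry (suc a) (y , t)) ≡ (y , t) ∷ []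
  h y t n1 n2 rewrite deleteEntry-other {suc a} {y} t n2 with <-cmp y a
  ... | tri≈ _ e _ = ⊥-elim (n1 e)
  ... | tri< y<a _ _ rewrite lower-≤ (≤-trans (<⇒≤ y<a) (n≤1+n a)) | inflateEntry-other {a} {y} t n1 | raise-≤ (<⇒≤ y<a) = refl
  ... | tri> _ _ a<y with <-cmp y (suc a)
  ...   | tri≈ _ e _ = ⊥-elim (n2 e)
  ...   | tri< y<sa _ _ = ⊥-elim (<-irrefl refl (≤-trans y<sa a<y))
  ...   | tri> _ _ sa<y rewrite lower-> sa<y | inflateEntry-other {a} {pred y} t (>⇒≢ (pred-mono-pos (s≤s z≤n) sa<y)) | raise-> (pred-mono-pos (s≤s z≤n) sa<y) | suc-pred-pos (≤-trans (s≤s z≤n) sa<y) = refl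

inflate-delete-decStrip : ∀ b X0 Y0 → Avoids₂ b (suc b) X0 → Avoids₂ b (suc b) Y0 →
  inflate b (delete b (X0 ++ ((suc b , neg) ∷ (b , neg) ∷ []) ++ Y0)) ≡ X0 ++ ((suc b , neg) ∷ (b , neg) ∷ []) ++ Y0
inflate-delete-decStrip b X0 Y0 a1 a2 = inflate-delete-around b b b (suc b) X0 _ Y0 a1 a2 h hp
  where
  hp : inflate b (delete b ((suc b , neg) ∷ (b , neg) ∷ [])) ≡ (suc b , neg) ∷ (b , neg) ∷ []
  hp rewrite deleteEntry-other {b} {suc b} neg (>⇒≢ (n<1+n b)) | lower-> (n<1+n b) | deleteEntry-self b neg | inflateEntry-self b neg = refl
  h : ∀ y t → y ≢ b → y ≢ suc b → inflate b (deleteEntry b (y , t)) ≡ (y , t) ∷ []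
  h y t n1 n2 rewrite deleteEntry-other {b} {y} t n1 with <-cmp y b
  ... | tri≈ _ e _ = ⊥-elim (n1 e)
  ... | tri< y<b _ _ rewrite lower-≤ (<⇒≤ y<b) | inflateEntry-other {b} {y} t n1 | raise-≤ (<⇒≤ y<b) = refl
  ... | tri> _ _ b<y with <-cmp y (suc b)
  ...   | tri≈ _ e _ = ⊥-elim (n2 e)
  ...   | tri< y<sb _ _ = ⊥-elim (<-irrefl refl (≤-trans y<sb b<y))
  ...   | tri> _ _ sb<y rewrite lower-> b<y | inflateEntry-other {b} {pred y} t (>⇒≢ (pred-mono-pos (s≤s z≤n) sb<y)) | raise-> (pred-mono-pos (s≤s z≤n) sb<y) | suc-pred-pos (≤-trans (s≤s z≤n) b<y) = refl

inflate-delete-strip : ∀ c s → s ≢ dot → ∀ X0 Y0 → Avoids₂ c (suc c) X0 → Avoids₂ c (suc c) Y0 →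
  inflate c (delete (proj₁ (stripSecond c s)) (X0 ++ stripFirst c s ∷ stripSecond c s ∷ Y0)) ≡ X0 ++ stripFirst c s ∷ stripSecond c s ∷ Y0
inflate-delete-strip c pos _ = inflate-delete-incStrip c
inflate-delete-strip c neg _ = inflate-delete-decStrip c
inflate-delete-strip c dot s≢dot = ⊥-elim (s≢dot refl)

split-unique : ∀ xs (e : Entry) ys xs' ys' → xs ++ e ∷ ys ≡ xs' ++ e ∷ ys' → Unique (vals (xs ++ e ∷ ys)) → xs ≡ xs' × ys ≡ ys'
split-unique [] e ys [] ys' eq u = refl , proj₂ (∷-injective eq)
split-unique [] e ys (x' ∷ xs') ys' eq u with ∷-injective eq
... | refl , eq2 = ⊥-elim (All-middle xs' e ys' (subst (All (λ f → proj₁ f ≢ proj₁ e)) eq2 (proj₂ (unique-split [] e ys u))) refl)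
split-unique (x ∷ xs) e ys [] ys' eq u with ∷-injective eq
... | refl , eq2 = ⊥-elim (hd (proj₁ (unique-split (x ∷ xs) x ys u)) refl)
  where
  hd : ∀ {P : Entry → Set} {a as} → All P (a ∷ as) → P a
  hd (p ∷ _) = p
split-unique (x ∷ xs) e ys (x' ∷ xs') ys' eq (_ ∷ u) with ∷-injective eq
... | refl , eq2 = let (a , b) = split-unique xs e ys xs' ys' eq2 u in cong (x ∷_) a , b

deleteAll-stepWord : ∀ α x s β W P e Y → s ≢ dot → Avoids x α → Avoids x β →
   P ++ e ∷ Y ≡ deleteAll W (inflate x (α ++ (x , s) ∷ β)) →
   deleteAll W (stripFirst x s ∷ []) ≡ e ∷ [] →
   Unique (vals (P ++ e ∷ Y)) →
   revFlip (P ++ e ∷ []) ++ Y ≡ deleteAll W (stepWord α x s β)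
deleteAll-stepWord α x s β W P e Y nd na nb eq he u = begin
  revFlip (P ++ e ∷ []) ++ Y ≡⟨ cong₂ (λ a b → revFlip (a ++ e ∷ []) ++ b) (proj₁ al) (proj₂ al) ⟩
  revFlip (deleteAll W (bump x α) ++ e ∷ []) ++ deleteAll W (stripSecond x s ∷ bump x β) ≡⟨ cong (λ z → revFlip (deleteAll W (bump x α) ++ z) ++ deleteAll W (stripSecond x s ∷ bump x β)) (sym he) ⟩
  revFlip (deleteAll W (bump x α) ++ deleteAll W (stripFirst x s ∷ [])) ++ deleteAll W (stripSecond x s ∷ bump x β) ≡⟨ cong (λ z → revFlip z ++ deleteAll W (stripSecond x s ∷ bump x β)) (sym (deleteAll-++ W (bump x α) _)) ⟩
  revFlip (deleteAll W (bump x α ++ stripFirst x s ∷ [])) ++ deleteAll W (stripSecond x s ∷ bump x β) ≡⟨ cong (_++ deleteAll W (stripSecond x s ∷ bump x β)) (sym (deleteAll-revFlip W _)) ⟩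
  deleteAll W (revFlip (bump x α ++ stripFirst x s ∷ [])) ++ deleteAll W (stripSecond x s ∷ bump x β) ≡⟨ sym (deleteAll-++ W _ _) ⟩
  deleteAll W (stepWord α x s β) ∎
  where
  open ≡-Reasoning
  I : inflate x (α ++ (x , s) ∷ β) ≡ bump x α ++ stripFirst x s ∷ stripSecond x s ∷ bump x β
  I = inflate-split α x s β na nb
  D : deleteAll W (inflate x (α ++ (x , s) ∷ β)) ≡ deleteAll W (bump x α) ++ e ∷ deleteAll W (stripSecond x s ∷ bump x β)
  D = trans (cong (deleteAll W) I) (trans (deleteAll-++ W (bump x α) (stripFirst x s ∷ stripSecond x s ∷ bump x β))
        (cong (deleteAll W (bump x α) ++_) (trans (deleteAll-++ W (stripFirst x s ∷ []) (stripSecond x s ∷ bump x β)) (cong (_++ deleteAll W (stripSecond x s ∷ bump x β)) he))))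
  al = split-unique P e Y (deleteAll W (bump x α)) (deleteAll W (stripSecond x s ∷ bump x β)) (trans eq D) u

delete-bump : ∀ x β → Avoids x β → delete x (bump x β) ≡ β
delete-bump x [] [] = refl
delete-bump x ((y , t) ∷ β) (y≢x ∷ a) with <-cmp y x
... | tri≈ _ y≡x _ = ⊥-elim (y≢x y≡x)
... | tri< y<x _ _ rewrite raise-≤ (<⇒≤ y<x) | deleteEntry-below {x} t y<x = cong ((y , t) ∷_) (delete-bump x β a)
... | tri> _ _ x<y rewrite raise-> x<y | deleteEntry-above {x} t (m<n⇒m<1+n x<y) = cong ((y , t) ∷_) (delete-bump x β a)

delete-suc-bump : ∀ x β → Avoids x β → delete (suc x) (bump x β) ≡ β
delete-suc-bump x [] [] = refl
delete-suc-bump x ((y , t) ∷ β) (y≢x ∷ a) with <-cmp y x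
... | tri≈ _ y≡x _ = ⊥-elim (y≢x y≡x)
... | tri< y<x _ _ rewrite raise-≤ (<⇒≤ y<x) | deleteEntry-below {suc x} t (m<n⇒m<1+n y<x) = cong ((y , t) ∷_) (delete-suc-bump x β a)
... | tri> _ _ x<y rewrite raise-> x<y | deleteEntry-above {suc x} t (s≤s x<y) = cong ((y , t) ∷_) (delete-suc-bump x β a)

gen-lift-step : ∀ {k g} → Gen k g → ∃ λ g′ → ∃ λ W → Gen (suc k) g′ × g ≡ deleteAll W g′
gen-lift-step {k} {g} G with gen-invariant G
... | (sortable , undotted , _ , g-length) = step-first g g-length undotted (peg⇒unique g (sortable⇒peg k g sortable)) G
  where
  step-first : ∀ g → length g ≡ suc k → All Undotted g → Unique (vals g) → Gen k g → ∃ λ g′ → ∃ λ W → Gen (suc k) g′ × g ≡ deleteAll W g′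
  step-first [] () _ _ _
  step-first ((x , pos) ∷ β) _ _ u G = _ , [ x ] , gen-step G (step+ [] x β) , sym deleted
    where
    deleted : delete x ((x , neg) ∷ (suc x , pos) ∷ bump x β) ≡ (x , pos) ∷ β
    deleted rewrite deleteEntry-self x neg | deleteEntry-above {x} pos (n<1+n x) =
      cong ((x , pos) ∷_) (delete-bump x β (proj₂ (unique-split [] (x , pos) β u)))
  step-first ((x , neg) ∷ β) _ _ u G = _ , [ suc x ] , gen-step G (step- [] x β) , sym deleted
    where
    deleted : delete (suc x) ((suc x , pos) ∷ (x , neg) ∷ bump x β) ≡ (x , neg) ∷ β
    deleted rewrite deleteEntry-self (suc x) pos | deleteEntry-below {suc x} neg (n<1+n x) =
      cong ((x , neg) ∷_) (delete-suc-bump x β (proj₂ (unique-split [] (x , neg) β u)))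
  step-first ((x , dot) ∷ β) _ (x≢dot ∷ _) _ _ = ⊥-elim (x≢dot refl)

gen-lift : ∀ {k g} m → Gen k g → k ≤ m → ∃ λ g′ → ∃ λ W → Gen m g′ × g ≡ deleteAll W g′
gen-lift {k} {g} m G le with m ≟ k
... | yes refl = g , [] , G , refl
... | no ne with m
...   | zero = ⊥-elim (ne (sym (n≤0⇒n≡0 le)))
...   | suc m' with gen-lift m' G (≤-pred (≤∧≢⇒< le (λ e → ne (sym e))))
...     | (h1 , W1 , G1 , e1) with gen-lift-step G1
...       | (h2 , W2 , G2 , e2) = h2 , W2 ++ W1 , G2 , trans e1 (trans (cong (deleteAll W1) e2) (sym (deleteAll-++-values W2 W1 h2)))

identity-deletionOfBase : ∀ q → All Undotted q → CleanCompact q → IsIdentityPeg q → ∃ λ W → q ≡ deleteAll W ((1 , pos) ∷ [])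
identity-deletionOfBase [] _ _ _ = 1 ∷ [] , refl
identity-deletionOfBase ((y , t) ∷ []) (d ∷ []) _ (e , (n ∷ [])) with ∷-injective e
... | refl , _ = [] , cong (λ s → (1 , s) ∷ []) (sgn t d n)
  where
  sgn : ∀ t → t ≢ dot → t ≢ neg → t ≡ pos
  sgn pos _ _ = refl
  sgn neg _ n = ⊥-elim (n refl)
  sgn dot d _ = ⊥-elim (d refl)
identity-deletionOfBase ((y , t) ∷ (y' , t') ∷ q) _ (cc-cons _ _ _ ni _ _) (e , (n ∷ n' ∷ _)) with ∷-injective e
... | refl , e2 with ∷-injective e2
... | refl , _ = ⊥-elim (ni (refl , n , n'))

-- Contracting a strip of length two

lowerEntry : ℕ → Entry → Entry
lowerEntry b e = lower b (proj₁ e) , proj₂ e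

delete-avoiding : ∀ b Z → Avoids b Z → delete b Z ≡ map (lowerEntry b) Z
delete-avoiding b [] [] = refl
delete-avoiding b ((y , t) ∷ Z) (ne ∷ a) rewrite deleteEntry-other {b} {y} t ne = cong (_ ∷_) (delete-avoiding b Z a)

lower-suc : ∀ b y z → y ≢ b → z ≢ b → lower b z ≡ suc (lower b y) → (z ≡ suc y) ⊎ (y ≡ pred b × z ≡ suc b)
lower-suc b y z yb zb e with <-cmp y b | <-cmp z b
... | tri≈ _ q _ | _ = ⊥-elim (yb q)
... | _ | tri≈ _ q _ = ⊥-elim (zb q)
... | tri< y<b _ _ | tri< z<b _ _ rewrite lower-≤ (<⇒≤ y<b) | lower-≤ (<⇒≤ z<b) = inj₁ e
... | tri> _ _ b<y | tri> _ _ b<z rewrite lower-> b<y | lower-> b<z =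
      inj₁ (trans (sym (suc-pred-pos (≤-trans (s≤s z≤n) b<z))) (trans (cong suc e) (cong suc (suc-pred-pos (≤-trans (s≤s z≤n) b<y)))))
... | tri< y<b _ _ | tri> _ _ b<z rewrite lower-≤ (<⇒≤ y<b) | lower-> b<z = inj₂ (yb' , zb')
  where
  zeq : z ≡ suc (suc y)
  zeq = trans (sym (suc-pred-pos (≤-trans (s≤s z≤n) b<z))) (cong suc e)
  bsy : b ≡ suc y
  bsy = ≤-antisym (≤-pred (subst (b <_) zeq b<z)) y<b
  yb' : y ≡ pred b
  yb' = cong pred (sym bsy)
  zb' : z ≡ suc b
  zb' = trans zeq (cong suc (sym bsy))
... | tri> _ _ b<y | tri< z<b _ _ rewrite lower-> b<y | lower-≤ (<⇒≤ z<b) =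
      ⊥-elim (<-asym b<y (subst (_< b) (trans e (suc-pred-pos (≤-trans (s≤s z≤n) b<y))) z<b))

AvoidsEntry₂ : ℕ → ℕ → Entry → Set
AvoidsEntry₂ b w e = proj₁ e ≢ b × proj₁ e ≢ w

unlinked-lower : ∀ b w → (w ≡ pred b ⊎ w ≡ suc b) → ∀ e f → AvoidsEntry₂ b w e → AvoidsEntry₂ b w f → Unlinked e f → Unlinked (lowerEntry b e) (lowerEntry b f)
unlinked-lower b w hw (y , s) (z , t) (yb , yw) (zb , zw) (ni , nd) =
  (λ { (q , u , v) → inc hw (lower-suc b y z yb zb q) u v }) ,
  (λ { (q , u , v) → dec hw (lower-suc b z y zb yb q) u v })
  where
  inc : (w ≡ pred b ⊎ w ≡ suc b) → (z ≡ suc y) ⊎ (y ≡ pred b × z ≡ suc b) → s ≢ neg → t ≢ neg → ⊥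
  inc _ (inj₁ q) u v = ni (q , u , v)
  inc (inj₁ r) (inj₂ (q1 , q2)) u v = yw (trans q1 (sym r))
  inc (inj₂ r) (inj₂ (q1 , q2)) u v = zw (trans q2 (sym r))
  dec : (w ≡ pred b ⊎ w ≡ suc b) → (y ≡ suc z) ⊎ (z ≡ pred b × y ≡ suc b) → s ≢ pos → t ≢ pos → ⊥
  dec _ (inj₁ q) u v = nd (q , u , v)
  dec (inj₁ r) (inj₂ (q1 , q2)) u v = zw (trans q1 (sym r))
  dec (inj₂ r) (inj₂ (q1 , q2)) u v = yw (trans q2 (sym r))

snoc-view : ∀ (xs : Word) → (xs ≡ []) ⊎ (∃₂ λ ys y → xs ≡ ys ++ y ∷ [])
snoc-view [] = inj₁ refl
snoc-view (x ∷ xs) with snoc-view xs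
... | inj₁ refl = inj₂ ([] , x , refl)
... | inj₂ (ys , y , refl) = inj₂ (x ∷ ys , y , refl)

avoids₂⇒avoids : ∀ {c b} Z → Avoids₂ c b Z → Avoids b Z
avoids₂⇒avoids Z a = All.map proj₂ a

avoids₂⇒all : ∀ {c b w} Z → Avoids₂ c b Z → (∀ {y} → y ≢ c → y ≢ b → y ≢ w) → All (AvoidsEntry₂ b w) Z
avoids₂⇒all Z a h = All.map (λ (≢c , ≢b) → ≢b , h ≢c ≢b) a

cc-last-pair : ∀ Z z e → CleanCompact (Z ++ z ∷ e ∷ []) → Unlinked z e
cc-last-pair Z z e c = cc-head z e [] (cc-++ʳ Z _ c)

cc-∷-map : ∀ (g : Entry → Entry) (P : Entry → Set) (h : ∀ e f → P e → P f → Unlinked e f → Unlinked (g e) (g f))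
  e' Y0 → All P Y0 → CleanCompact Y0 → (∀ y ys → Y0 ≡ y ∷ ys → Unlinked e' (g y)) → CleanCompact (e' ∷ map g Y0)
cc-∷-map g P h e' [] _ _ _ = cc-one e'
cc-∷-map g P h e' (y ∷ ys) pY cY jr = cc-cons e' (g y) (map g ys) (proj₁ (jr y ys refl)) (proj₂ (jr y ys refl)) (cc-map g P h (y ∷ ys) pY cY)

cc-map-around : ∀ (g : Entry → Entry) (P : Entry → Set) (h : ∀ e f → P e → P f → Unlinked e f → Unlinked (g e) (g f))
  X0 e e' Y0 → All P X0 → All P Y0 → CleanCompact (X0 ++ e ∷ []) → CleanCompact Y0 →
  (∀ z → P z → Unlinked z e → Unlinked (g z) e') → (∀ y ys → Y0 ≡ y ∷ ys → Unlinked e' (g y)) →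
  CleanCompact (map g X0 ++ e' ∷ map g Y0)
cc-map-around g P h X0 e e' Y0 pX pY cX cY jl jr = cc-++ (map g X0) e' (map g Y0) L R
  where
  L : CleanCompact (map g X0 ++ e' ∷ [])
  L with snoc-view X0
  ... | inj₁ refl = cc-one e'
  ... | inj₂ (Z , z , refl) = subst CleanCompact (sym (trans (cong (_++ e' ∷ []) (map-++ g Z (z ∷ []))) (++-assoc (map g Z) _ _)))
        (cc-∷ʳ (map g Z) (g z) e' (subst CleanCompact (map-++ g Z (z ∷ [])) (cc-map g P h (Z ++ z ∷ []) pX (cc-++ˡ (Z ++ z ∷ []) (e ∷ []) cX)))
          (jl z (All-middle Z z [] pX) (cc-last-pair Z z e (subst CleanCompact (++-assoc Z (z ∷ []) (e ∷ [])) cX))))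
  R : CleanCompact (e' ∷ map g Y0)
  R = cc-∷-map g P h e' Y0 pY cY jr

cc-delete-incStrip : ∀ a X0 Y0 → Avoids₂ a (suc a) X0 → Avoids₂ a (suc a) Y0 → CleanCompact (X0 ++ (a , pos) ∷ []) → CleanCompact ((suc a , pos) ∷ Y0) →
  CleanCompact (delete (suc a) (X0 ++ (a , pos) ∷ (suc a , pos) ∷ Y0))
cc-delete-incStrip a X0 Y0 aX aY cX cY = subst CleanCompact (sym E)
  (cc-map-around (lowerEntry (suc a)) (AvoidsEntry₂ (suc a) a) (unlinked-lower (suc a) a (inj₁ refl)) X0 (a , pos) (a , pos) Y0
    (avoids₂⇒all X0 aX (λ n1 _ → n1)) (avoids₂⇒all Y0 aY (λ n1 _ → n1)) cX (cc-tail _ Y0 cY) jl (jr Y0 aY cY))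
  where
  E : delete (suc a) (X0 ++ (a , pos) ∷ (suc a , pos) ∷ Y0) ≡ map (lowerEntry (suc a)) X0 ++ (a , pos) ∷ map (lowerEntry (suc a)) Y0
  E = trans (substitute-++ (deleteEntry (suc a)) X0 _) (cong₂ _++_ (delete-avoiding (suc a) X0 (avoids₂⇒avoids X0 aX)) E2)
    where
    E2 : delete (suc a) ((a , pos) ∷ (suc a , pos) ∷ Y0) ≡ (a , pos) ∷ map (lowerEntry (suc a)) Y0
    E2 rewrite deleteEntry-other {suc a} {a} pos (<⇒≢ (n<1+n a)) | lower-≤ (n≤1+n a) | deleteEntry-self (suc a) pos = cong ((a , pos) ∷_) (delete-avoiding (suc a) Y0 (avoids₂⇒avoids Y0 aY))
  jl : ∀ z → AvoidsEntry₂ (suc a) a z → Unlinked z (a , pos) → Unlinked (lowerEntry (suc a) z) (a , pos)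
  jl (y , r) (n1 , n2) (ni , nd) = (λ { (q , u , v) → inc q u v }) , (λ { (_ , _ , v) → v refl })
    where
    inc : a ≡ suc (lower (suc a) y) → r ≢ neg → pos ≢ neg → ⊥
    inc q u v with <-cmp y (suc a)
    ... | tri≈ _ e _ = n1 e
    ... | tri< y<sa _ _ rewrite lower-≤ (<⇒≤ y<sa) = ni (q , u , v)
    ... | tri> _ _ sa<y rewrite lower-> sa<y = <-irrefl (trans q (suc-pred-pos (≤-trans (s≤s z≤n) sa<y))) (<-trans (n<1+n a) sa<y)
  jr : ∀ Y0 → Avoids₂ a (suc a) Y0 → CleanCompact ((suc a , pos) ∷ Y0) → ∀ y ys → Y0 ≡ y ∷ ys → Unlinked (a , pos) (lowerEntry (suc a) y)
  jr .((z , t) ∷ ys) ((n1 , n2) ∷ _) cY (z , t) ys refl with cc-head _ _ ys cY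
  ... | (ni , nd) = (λ { (q , u , v) → inc q v }) , (λ { (_ , u , _) → u refl })
    where
    inc : lower (suc a) z ≡ suc a → t ≢ neg → ⊥
    inc q v with <-cmp z (suc a)
    ... | tri≈ _ e _ = n2 e
    ... | tri< z<sa _ _ rewrite lower-≤ (<⇒≤ z<sa) = n2 q
    ... | tri> _ _ sa<z rewrite lower-> sa<z = ni (trans (sym (suc-pred-pos (≤-trans (s≤s z≤n) sa<z))) (cong suc q) , (λ ()) , v)

cc-delete-decStrip : ∀ b X0 Y0 → Avoids₂ b (suc b) X0 → Avoids₂ b (suc b) Y0 → CleanCompact (X0 ++ (suc b , neg) ∷ []) → CleanCompact ((b , neg) ∷ Y0) →
  CleanCompact (delete b (X0 ++ (suc b , neg) ∷ (b , neg) ∷ Y0))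
cc-delete-decStrip b X0 Y0 aX aY cX cY = subst CleanCompact (sym E)
  (cc-map-around (lowerEntry b) (AvoidsEntry₂ b (suc b)) (unlinked-lower b (suc b) (inj₂ refl)) X0 (suc b , neg) (b , neg) Y0
    aX aY cX (cc-tail _ Y0 cY) jl (jr Y0 aY cY))
  where
  E : delete b (X0 ++ (suc b , neg) ∷ (b , neg) ∷ Y0) ≡ map (lowerEntry b) X0 ++ (b , neg) ∷ map (lowerEntry b) Y0
  E = trans (substitute-++ (deleteEntry b) X0 _) (cong₂ _++_ (delete-avoiding b X0 (All.map proj₁ aX)) E2)
    where
    E2 : delete b ((suc b , neg) ∷ (b , neg) ∷ Y0) ≡ (b , neg) ∷ map (lowerEntry b) Y0
    E2 rewrite deleteEntry-other {b} {suc b} neg (>⇒≢ (n<1+n b)) | lower-> (n<1+n b) | deleteEntry-self b neg = cong ((b , neg) ∷_) (delete-avoiding b Y0 (All.map proj₁ aY))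
  jl : ∀ z → AvoidsEntry₂ b (suc b) z → Unlinked z (suc b , neg) → Unlinked (lowerEntry b z) (b , neg)
  jl (y , r) (n1 , n2) (ni , nd) = (λ { (_ , _ , v) → v refl }) , (λ { (q , u , v) → dec q u v })
    where
    dec : lower b y ≡ suc b → r ≢ pos → neg ≢ pos → ⊥
    dec q u v with <-cmp y b
    ... | tri≈ _ e _ = n1 e
    ... | tri< y<b _ _ rewrite lower-≤ (<⇒≤ y<b) = n2 q
    ... | tri> _ _ b<y rewrite lower-> b<y = nd (trans (sym (suc-pred-pos (≤-trans (s≤s z≤n) b<y))) (cong suc q) , u , v)
  jr : ∀ Y0 → Avoids₂ b (suc b) Y0 → CleanCompact ((b , neg) ∷ Y0) → ∀ y ys → Y0 ≡ y ∷ ys → Unlinked (b , neg) (lowerEntry b y)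
  jr .((z , t) ∷ ys) ((n1 , n2) ∷ _) cY (z , t) ys refl with cc-head _ _ ys cY
  ... | (ni , nd) = (λ { (_ , u , _) → u refl }) , (λ { (q , u , v) → dec q v })
    where
    dec : b ≡ suc (lower b z) → t ≢ pos → ⊥
    dec q v with <-cmp z b
    ... | tri≈ _ e _ = n1 e
    ... | tri< z<b _ _ rewrite lower-≤ (<⇒≤ z<b) = nd (q , (λ ()) , v)
    ... | tri> _ _ b<z rewrite lower-> b<z = <-irrefl (trans q (suc-pred-pos (≤-trans (s≤s z≤n) b<z))) b<z

cc-delete-strip : ∀ c s → s ≢ dot → ∀ X0 Y0 → Avoids₂ c (suc c) X0 → Avoids₂ c (suc c) Y0 →
  CleanCompact (X0 ++ [ stripFirst c s ]) → CleanCompact (stripSecond c s ∷ Y0) →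
  CleanCompact (delete (proj₁ (stripSecond c s)) (X0 ++ stripFirst c s ∷ stripSecond c s ∷ Y0))
cc-delete-strip c pos _ = cc-delete-incStrip c
cc-delete-strip c neg _ = cc-delete-decStrip c
cc-delete-strip c dot s≢dot = ⊥-elim (s≢dot refl)

-- Clean compact words sortable by k reversals are deletions of elements of G_k

DeletionOfGen : ℕ → Word → Set
DeletionOfGen k q = ∃ λ g → ∃ λ W → Gen k g × q ≡ deleteAll W g

CleanSortable⇒Deletion : ℕ → Set
CleanSortable⇒Deletion n = ∀ js q → length js ≤ n → All Undotted q → CleanCompact q → IsIdentityPeg (applyRevs q js) →
  DeletionOfGen (length js) q

∈-middle : ∀ (X0 : Word) e Y → e ∈ X0 ++ e ∷ Y
∈-middle X0 e Y = ∈-++⁺ʳ X0 (here refl)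

delete-stripFirst : ∀ c s → s ≢ dot → delete (proj₁ (stripSecond c s)) (stripFirst c s ∷ []) ≡ (c , s) ∷ []
delete-stripFirst c pos _ rewrite deleteEntry-other {suc c} {c} pos (<⇒≢ (n<1+n c)) | lower-≤ (n≤1+n c) = refl
delete-stripFirst c neg _ rewrite deleteEntry-other {c} {suc c} neg (>⇒≢ (n<1+n c)) | lower-> (n<1+n c) = refl
delete-stripFirst c dot s≢dot = ⊥-elim (s≢dot refl)

-- The step of g' at x, followed by the same deletions, gives the reversed word.
deletionOfGen-step : ∀ {k} g' x s X0 e Y → Gen k g' → s ≢ dot → (x , s) ∈ g' →
  (∃ λ W → (X0 ++ e ∷ Y ≡ deleteAll W (inflate x g')) × (deleteAll W (stripFirst x s ∷ []) ≡ e ∷ [])) →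
  Unique (vals (X0 ++ e ∷ Y)) →
  DeletionOfGen (suc k) (revFlip (X0 ++ e ∷ []) ++ Y)
deletionOfGen-step {k} g' x s X0 e Y G s≢dot x∈ (W , eq , first↦e) u with ∈-∃++ x∈
... | (α , β , refl) with gen-invariant G
... | (sortable , _ , _ , _) =
  stepWord α x s β , W , gen-step G (stepWord-step α x s β s≢dot) ,
  deleteAll-stepWord α x s β W X0 e Y s≢dot α-avoids β-avoids eq first↦e u
  where
  α-avoids = proj₁ (unique-split α (x , s) β (peg⇒unique _ (sortable⇒peg k _ sortable)))
  β-avoids = proj₂ (unique-split α (x , s) β (peg⇒unique _ (sortable⇒peg k _ sortable)))

unlinked-junction-case : ∀ {n} → CleanSortable⇒Deletion n → ∀ js → length js ≤ n → ∀ X0 e Y →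
  All Undotted (X0 ++ e ∷ Y) → CleanCompact (X0 ++ e ∷ Y) → IsIdentityPeg (applyRevs (X0 ++ e ∷ Y) js) →
  DeletionOfGen (suc (length js)) (revFlip (X0 ++ e ∷ []) ++ Y)
unlinked-junction-case ih js l X0 (c , s) Y undotted cc i with ih js (X0 ++ (c , s) ∷ Y) l undotted cc i
... | (g' , W , G , eq) with ∈-deleteAll⁻ W g' (c , s) (subst ((c , s) ∈_) eq (∈-middle X0 (c , s) Y))
... | (x , x∈ , x↦c) with inflate-deleteAll-image W x s c x↦c
... | (W' , commute , first↦) =
  deletionOfGen-step g' x s X0 (c , s) Y G s≢dot x∈ (W' ++ [ second ] , q≡ , first↦c) u
  where
  q = X0 ++ (c , s) ∷ Y
  second = proj₁ (stripSecond c s)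
  s≢dot = All-middle X0 (c , s) Y undotted
  u = peg⇒unique q (sortable⇒peg (length js) q (js , ≤-refl , i))
  only-c-is-c : All (λ f → proj₁ f ≡ c → proj₂ f ≡ s) q
  only-c-is-c = AllP.++⁺ (All.map (λ n e → ⊥-elim (n e)) (proj₁ (unique-split X0 (c , s) Y u)))
                         ((λ _ → refl) ∷ All.map (λ n e → ⊥-elim (n e)) (proj₂ (unique-split X0 (c , s) Y u)))
  q≡ : q ≡ deleteAll (W' ++ [ second ]) (inflate x g')
  q≡ = begin
    q                                         ≡⟨ sym (delete-inflate-inverse c s s≢dot q only-c-is-c) ⟩
    delete second (inflate c q)               ≡⟨ cong (λ z → delete second (inflate c z)) eq ⟩
    delete second (inflate c (deleteAll W g')) ≡⟨ cong (delete second) (commute g') ⟩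
    delete second (deleteAll W' (inflate x g')) ≡⟨ sym (deleteAll-++-values W' [ second ] (inflate x g')) ⟩
    deleteAll (W' ++ [ second ]) (inflate x g') ∎
    where open ≡-Reasoning
  first↦c : deleteAll (W' ++ [ second ]) (stripFirst x s ∷ []) ≡ (c , s) ∷ []
  first↦c = trans (deleteAll-++-values W' [ second ] _) (trans (cong (delete second) first↦) (delete-stripFirst c s s≢dot))

deleteEntry-undotted : ∀ v e → Undotted e → All Undotted (deleteEntry v e)
deleteEntry-undotted v (y , t) undotted with y ≟ v
... | yes refl rewrite deleteEntry-self y t = []
... | no y≢v rewrite deleteEntry-other {v} {y} t y≢v = undotted ∷ []

∈-delete⁺ : ∀ v w y t → (y , t) ∈ w → y ≢ v → (lower v y , t) ∈ delete v w
∈-delete⁺ v ((y , t) ∷ w) y t (here refl) y≢v = subst ((lower v y , t) ∈_) (sym (cong (_++ delete v w) (deleteEntry-other t y≢v))) (here refl)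
∈-delete⁺ v (e ∷ w) y t (there y∈) y≢v = ∈-++⁺ʳ (deleteEntry v e) (∈-delete⁺ v w y t y∈ y≢v)

deletionOfGen-delete : ∀ {n} → CleanSortable⇒Deletion n → ∀ js → length js ≤ n → ∀ b q → 1 ≤ b → All Undotted q →
  IsIdentityPeg (applyRevs q js) → CleanCompact (delete b q) → DeletionOfGen (length js) (delete b q)
deletionOfGen-delete {n} ih js l b q b≥1 undotted i cc
  with ih (liftRevs (deleteEntry b) q js) (delete b q) (subst (_≤ n) (sym (length-liftRevs (deleteEntry b) q js)) l)
          (All-substitute (deleteEntry b) (deleteEntry-undotted b) q undotted) cc
          (subst IsIdentityPeg (sym (applyRevs-substitute (deleteEntry b) (λ _ _ → tt) (λ e _ → deleteEntry-equivariant b e) q js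
                                                           (All.universal (λ _ → tt) q)))
                 (delete-identity b b≥1 _ i))
... | (g , W , G , e) = g , W , subst (λ k → Gen k g) (length-liftRevs (deleteEntry b) q js) G , e

strip-avoids : ∀ c s X0 Y0 → Unique (vals (X0 ++ stripFirst c s ∷ stripSecond c s ∷ Y0)) →
  Avoids₂ c (suc c) X0 × Avoids₂ c (suc c) Y0
strip-avoids c s X0 Y0 u with unique-split X0 (stripFirst c s) (stripSecond c s ∷ Y0) u
                           | unique-split (X0 ++ [ stripFirst c s ]) (stripSecond c s) Y0
                               (subst (λ z → Unique (vals z)) (sym (++-assoc X0 [ stripFirst c s ] (stripSecond c s ∷ Y0))) u)
... | (X0-first , Y0-first) | (X0-second , Y0-second) =
  orient s (All.zip (X0-first , AllP.++⁻ˡ X0 X0-second)) , orient s (All.zip (All.tail Y0-first , Y0-second))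
  where
  orient : ∀ s {Z} → All (λ f → proj₁ f ≢ proj₁ (stripFirst c s) × proj₁ f ≢ proj₁ (stripSecond c s)) Z → Avoids₂ c (suc c) Z
  orient pos a = a
  orient neg a = All.map (λ (≢suc , ≢c) → ≢c , ≢suc) a
  orient dot a = a

-- A strip of length two at the junction is contracted by a deletion, which keeps the word
-- clean compact and sortable with the same reversals; the step rule re-inflates it.
strip-junction-case : ∀ {n} → CleanSortable⇒Deletion n → ∀ js → length js ≤ n → ∀ X0 c s Y0 → s ≢ dot →
  All Undotted (X0 ++ stripFirst c s ∷ stripSecond c s ∷ Y0) →
  CleanCompact (X0 ++ [ stripFirst c s ]) → CleanCompact (stripSecond c s ∷ Y0) →
  IsIdentityPeg (applyRevs (X0 ++ stripFirst c s ∷ stripSecond c s ∷ Y0) js) →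
  DeletionOfGen (suc (length js)) (revFlip (X0 ++ [ stripFirst c s ]) ++ stripSecond c s ∷ Y0)
strip-junction-case ih js l X0 c s Y0 s≢dot undotted cX cY i =
  from-deletion (deletionOfGen-delete ih js l second q second≥1 undotted i (cc-delete-strip c s s≢dot X0 Y0 X0-avoids Y0-avoids cX cY))
  where
  q = X0 ++ stripFirst c s ∷ stripSecond c s ∷ Y0
  second = proj₁ (stripSecond c s)
  peg = sortable⇒peg (length js) q (js , ≤-refl , i)
  X0-avoids = proj₁ (strip-avoids c s X0 Y0 (peg⇒unique q peg))
  Y0-avoids = proj₂ (strip-avoids c s X0 Y0 (peg⇒unique q peg))
  second≥1 : 1 ≤ second
  second≥1 = All-middle (X0 ++ [ stripFirst c s ]) (stripSecond c s) Y0
               (subst (All (λ e → 1 ≤ proj₁ e)) (sym (++-assoc X0 [ stripFirst c s ] (stripSecond c s ∷ Y0))) (peg⇒positive q peg))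
  first≢second : ∀ s → proj₁ (stripFirst c s) ≢ proj₁ (stripSecond c s)
  first≢second pos = <⇒≢ (n<1+n c)
  first≢second neg = >⇒≢ (n<1+n c)
  first≢second dot = <⇒≢ (n<1+n c)
  lower-first : ∀ s → lower (proj₁ (stripSecond c s)) (proj₁ (stripFirst c s)) ≡ c
  lower-first pos = lower-≤ (n≤1+n c)
  lower-first neg = lower-> (n<1+n c)
  lower-first dot = lower-≤ (n≤1+n c)
  first-sign : ∀ s → stripFirst c s ≡ (proj₁ (stripFirst c s) , s)
  first-sign pos = refl
  first-sign neg = refl
  first-sign dot = refl
  c∈ : (c , s) ∈ delete second q
  c∈ = subst (λ z → (z , s) ∈ delete second q) (lower-first s)
         (∈-delete⁺ second q _ s (subst (λ e → e ∈ q) (first-sign s) (∈-middle X0 (stripFirst c s) _)) (first≢second s))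
  from-deletion : DeletionOfGen (length js) (delete second q) →
    DeletionOfGen (suc (length js)) (revFlip (X0 ++ [ stripFirst c s ]) ++ stripSecond c s ∷ Y0)
  from-deletion (g' , W , G , eq) with ∈-deleteAll⁻ W g' (c , s) (subst ((c , s) ∈_) eq c∈)
  ... | (x , x∈ , x↦c) with inflate-deleteAll-image W x s c x↦c
  ... | (W' , commute , first↦) =
    deletionOfGen-step g' x s X0 (stripFirst c s) (stripSecond c s ∷ Y0) G s≢dot x∈ (W' , q≡ , first↦) (peg⇒unique q peg)
    where
    q≡ : q ≡ deleteAll W' (inflate x g')
    q≡ = trans (sym (inflate-delete-strip c s s≢dot X0 Y0 X0-avoids Y0-avoids)) (trans (cong (inflate c) eq) (commute g'))

_≟ˢ_ : (s t : Sign) → Dec (s ≡ t)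
pos ≟ˢ pos = yes refl
pos ≟ˢ neg = no λ ()
pos ≟ˢ dot = no λ ()
neg ≟ˢ pos = no λ ()
neg ≟ˢ neg = yes refl
neg ≟ˢ dot = no λ ()
dot ≟ˢ pos = no λ ()
dot ≟ˢ neg = no λ ()
dot ≟ˢ dot = yes refl

incLink? : ∀ e f → Dec (IncLink e f)
incLink? (a , s) (b , t) = (b ≟ suc a) ×-dec (¬? (s ≟ˢ neg) ×-dec ¬? (t ≟ˢ neg))

decLink? : ∀ e f → Dec (DecLink e f)
decLink? (a , s) (b , t) = (a ≟ suc b) ×-dec (¬? (s ≟ˢ pos) ×-dec ¬? (t ≟ˢ pos))

data StripPair : Entry → Entry → Set where
  strip-pair : ∀ c s → s ≢ dot → StripPair (stripFirst c s) (stripSecond c s)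

incLink⇒stripPair : ∀ e f → Undotted e → Undotted f → IncLink e f → StripPair e f
incLink⇒stripPair (a , pos) (.(suc a) , pos) _ _ (refl , _ , _) = strip-pair a pos (λ ())
incLink⇒stripPair (a , neg) _ _ _ (_ , s≢neg , _) = ⊥-elim (s≢neg refl)
incLink⇒stripPair (a , dot) _ s≢dot _ _ = ⊥-elim (s≢dot refl)
incLink⇒stripPair (a , pos) (_ , neg) _ _ (_ , _ , t≢neg) = ⊥-elim (t≢neg refl)
incLink⇒stripPair (a , pos) (_ , dot) _ t≢dot _ = ⊥-elim (t≢dot refl)

decLink⇒stripPair : ∀ e f → Undotted e → Undotted f → DecLink e f → StripPair e f
decLink⇒stripPair (.(suc b) , neg) (b , neg) _ _ (refl , _ , _) = strip-pair b neg (λ ())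
decLink⇒stripPair (a , pos) _ _ _ (_ , s≢pos , _) = ⊥-elim (s≢pos refl)
decLink⇒stripPair (a , dot) _ s≢dot _ _ = ⊥-elim (s≢dot refl)
decLink⇒stripPair (a , neg) (_ , pos) _ _ (_ , _ , t≢pos) = ⊥-elim (t≢pos refl)
decLink⇒stripPair (a , neg) (_ , dot) _ t≢dot _ = ⊥-elim (t≢dot refl)

linked-junction-case : ∀ {n} → CleanSortable⇒Deletion n → ∀ js → length js ≤ n → ∀ X0 e f Y0 → StripPair e f →
  All Undotted (X0 ++ e ∷ f ∷ Y0) → CleanCompact (X0 ++ [ e ]) → CleanCompact (f ∷ Y0) →
  IsIdentityPeg (applyRevs (X0 ++ e ∷ f ∷ Y0) js) → DeletionOfGen (suc (length js)) (revFlip (X0 ++ [ e ]) ++ f ∷ Y0)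
linked-junction-case ih js l X0 _ _ Y0 (strip-pair c s s≢dot) = strip-junction-case ih js l X0 c s Y0 s≢dot

junction-case : ∀ {n} → CleanSortable⇒Deletion n → ∀ js → length js ≤ n → ∀ X0 e Y →
  All Undotted (X0 ++ e ∷ Y) → CleanCompact (X0 ++ [ e ]) → CleanCompact Y → IsIdentityPeg (applyRevs (X0 ++ e ∷ Y) js) →
  DeletionOfGen (suc (length js)) (revFlip (X0 ++ [ e ]) ++ Y)
junction-case ih js l X0 e [] undotted cX cY i = unlinked-junction-case ih js l X0 e [] undotted cX i
junction-case ih js l X0 e (f ∷ Y0) undotted cX cY i with incLink? e f | decLink? e f
... | no ¬inc | no ¬dec =
  unlinked-junction-case ih js l X0 e (f ∷ Y0) undotted (cc-++ X0 e (f ∷ Y0) cX (cc-cons e f Y0 ¬inc ¬dec cY)) i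
... | yes inc | _ = linked-junction-case ih js l X0 e f Y0 (incLink⇒stripPair e f e-undotted f-undotted inc) undotted cX cY i
  where
  e-undotted = All-middle X0 e (f ∷ Y0) undotted
  f-undotted = All-middle (X0 ++ [ e ]) f Y0 (subst (All Undotted) (sym (++-assoc X0 [ e ] (f ∷ Y0))) undotted)
... | no _ | yes dec = linked-junction-case ih js l X0 e f Y0 (decLink⇒stripPair e f e-undotted f-undotted dec) undotted cX cY i
  where
  e-undotted = All-middle X0 e (f ∷ Y0) undotted
  f-undotted = All-middle (X0 ++ [ e ]) f Y0 (subst (All Undotted) (sym (++-assoc X0 [ e ] (f ∷ Y0))) undotted)

prefixRev-case : ∀ {n} → CleanSortable⇒Deletion n → ∀ js → length js ≤ n → ∀ X Y → All Undotted (X ++ Y) → CleanCompact (X ++ Y) →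
  IsIdentityPeg (applyRevs (revFlip X ++ Y) js) → DeletionOfGen (suc (length js)) (X ++ Y)
prefixRev-case ih js l [] Y undotted cc i with ih js Y l undotted cc i
... | (g , W , G , e) with gen-lift-step G
... | (g₂ , W₁ , G₂ , e₁) = g₂ , W₁ ++ W , G₂ , trans e (trans (cong (deleteAll W) e₁) (sym (deleteAll-++-values W₁ W g₂)))
prefixRev-case ih js l (x ∷ X1) Y undotted cc i =
  subst (DeletionOfGen (suc (length js))) unfold (junction-case ih js l (revFlip X1) (flipEntry x) Y undotted' cX cY i')
  where
  revFlip-x∷X1 : revFlip (x ∷ X1) ++ Y ≡ revFlip X1 ++ flipEntry x ∷ Y
  revFlip-x∷X1 = trans (cong (_++ Y) (revFlip-∷ x X1)) (++-assoc (revFlip X1) [ flipEntry x ] Y)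
  unfold : revFlip (revFlip X1 ++ [ flipEntry x ]) ++ Y ≡ (x ∷ X1) ++ Y
  unfold = cong (_++ Y) (trans (cong revFlip (sym (revFlip-∷ x X1))) (revFlip-involutive (x ∷ X1)))
  undotted' : All Undotted (revFlip X1 ++ flipEntry x ∷ Y)
  undotted' = subst (All Undotted) revFlip-x∷X1
    (AllP.++⁺ (All-revFlip Undotted-flipClosed (x ∷ X1) (AllP.++⁻ˡ (x ∷ X1) undotted)) (AllP.++⁻ʳ (x ∷ X1) undotted))
  cX : CleanCompact (revFlip X1 ++ [ flipEntry x ])
  cX = subst CleanCompact (revFlip-∷ x X1) (cc-revFlip (x ∷ X1) (cc-++ˡ (x ∷ X1) Y cc))
  cY : CleanCompact Y
  cY = cc-++ʳ (x ∷ X1) Y cc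
  i' : IsIdentityPeg (applyRevs (revFlip X1 ++ flipEntry x ∷ Y) js)
  i' = subst (λ z → IsIdentityPeg (applyRevs z js)) revFlip-x∷X1 i

cleanSortable⇒deletionOfGen : ∀ n → CleanSortable⇒Deletion n
cleanSortable⇒deletionOfGen n [] q l undotted cc i with identity-deletionOfBase q undotted cc i
... | (W , e) = _ , W , gen-base , e
cleanSortable⇒deletionOfGen zero (j ∷ js) q () undotted cc i
cleanSortable⇒deletionOfGen (suc n) (j ∷ js) q (s≤s l) undotted cc i =
  subst (DeletionOfGen (suc (length js))) (take++drop≡id j q)
    (prefixRev-case (cleanSortable⇒deletionOfGen n) js l (take j q) (drop j q)
      (subst (All Undotted) (sym (take++drop≡id j q)) undotted) (subst CleanCompact (sym (take++drop≡id j q)) cc) i)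

-- Patterns

StrictlyMonotoneOn : (ℕ → ℕ) → List ℕ → Set
StrictlyMonotoneOn h xs = ∀ {a b} → a ∈ xs → b ∈ xs → a < b → h a < h b

ImageUnder : (ℕ → ℕ) → Entry → Entry → Set
ImageUnder h e f = (proj₁ e ≡ h (proj₁ f)) × SignOK e f

-- A transitive strengthening of IsPattern: σ is the image of a subword of τ under a value map
-- that is strictly monotone on that subword.
MonotonePattern : Word → Word → Set
MonotonePattern σ τ = ∃ λ τ' → (τ' ⊆ τ) × ∃ λ h → Pointwise (ImageUnder h) σ τ' × StrictlyMonotoneOn h (vals τ')

⊆⇒vals-∈ : ∀ {xs ys : Word} {a} → xs ⊆ ys → a ∈ vals xs → a ∈ vals ys
⊆⇒vals-∈ s = Sublist.lookup (SublistP.map⁺ proj₁ s)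

Pointwise-restrict : ∀ {R : Entry → Entry → Set} {τ₁ τ υ₁} → τ₁ ⊆ τ → Pointwise R τ υ₁ →
  ∃ λ υ₂ → (υ₂ ⊆ υ₁) × Pointwise R τ₁ υ₂
Pointwise-restrict [] [] = [] , [] , []
Pointwise-restrict (y ∷ʳ s) (r ∷ pw) = let (υ₂ , s' , pw') = Pointwise-restrict s pw in υ₂ , _ ∷ʳ s' , pw'
Pointwise-restrict (refl ∷ s) (r ∷ pw) = let (υ₂ , s' , pw') = Pointwise-restrict s pw in _ ∷ υ₂ , refl ∷ s' , r ∷ pw'

image-∈ : ∀ {h xs ys a} → Pointwise (ImageUnder h) xs ys → a ∈ vals ys → h a ∈ vals xs
image-∈ ((e , _) ∷ pw) (here refl) = here (sym e)
image-∈ (_ ∷ pw) (there a∈) = there (image-∈ pw a∈)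

SignOK-trans : ∀ e f g → SignOK e f → SignOK f g → SignOK e g
SignOK-trans e f g (inj₁ dotted) _ = inj₁ dotted
SignOK-trans e f g (inj₂ q) (inj₁ dotted) = inj₁ (trans (sym q) dotted)
SignOK-trans e f g (inj₂ q) (inj₂ r) = inj₂ (trans r q)

ImageUnder-∘ : ∀ {h₁ h₂ xs ys zs} → Pointwise (ImageUnder h₁) xs ys → Pointwise (ImageUnder h₂) ys zs →
  Pointwise (ImageUnder (λ a → h₁ (h₂ a))) xs zs
ImageUnder-∘ [] [] = []
ImageUnder-∘ {h₁} {h₂} {x ∷ _} {y ∷ _} {z ∷ _} ((e₁ , s₁) ∷ p) ((e₂ , s₂) ∷ q) =
  (trans e₁ (cong h₁ e₂) , SignOK-trans x y z s₁ s₂) ∷ ImageUnder-∘ p q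

MonotonePattern-trans : ∀ {σ τ υ} → MonotonePattern σ τ → MonotonePattern τ υ → MonotonePattern σ υ
MonotonePattern-trans (τ₁ , s₁ , h₁ , pw₁ , mono₁) (υ₁ , s₂ , h₂ , pw₂ , mono₂) with Pointwise-restrict s₁ pw₂
... | (υ₂ , s₃ , pw₃) = υ₂ , ⊆-trans s₃ s₂ , (λ a → h₁ (h₂ a)) , ImageUnder-∘ pw₁ pw₃ ,
  λ a∈ b∈ a<b → mono₁ (image-∈ pw₃ a∈) (image-∈ pw₃ b∈) (mono₂ (⊆⇒vals-∈ s₃ a∈) (⊆⇒vals-∈ s₃ b∈) a<b)

Relaxes : Entry → Entry → Set
Relaxes e f = (proj₁ e ≡ proj₁ f) × SignOK e f

relaxation⇒monotonePattern : ∀ {σ τ} → Pointwise Relaxes σ τ → MonotonePattern σ τ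
relaxation⇒monotonePattern {τ = τ} pw = τ , ⊆-refl , (λ a → a) , pw , (λ _ _ a<b → a<b)

withoutValue : ℕ → Word → Word
withoutValue v [] = []
withoutValue v ((y , t) ∷ g) with y ≟ v
... | yes _ = withoutValue v g
... | no _ = (y , t) ∷ withoutValue v g

withoutValue-⊆ : ∀ v g → withoutValue v g ⊆ g
withoutValue-⊆ v [] = []
withoutValue-⊆ v ((y , t) ∷ g) with y ≟ v
... | yes _ = _ ∷ʳ withoutValue-⊆ v g
... | no _ = refl ∷ withoutValue-⊆ v g

withoutValue-∉ : ∀ v g {a} → a ∈ vals (withoutValue v g) → a ≢ v
withoutValue-∉ v ((y , t) ∷ g) a∈ with y ≟ v
... | yes _ = withoutValue-∉ v g a∈
withoutValue-∉ v ((y , t) ∷ g) (here refl) | no y≢v = y≢v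
withoutValue-∉ v ((y , t) ∷ g) (there a∈) | no _ = withoutValue-∉ v g a∈

delete-image : ∀ v g → Pointwise (ImageUnder (lower v)) (delete v g) (withoutValue v g)
delete-image v [] = []
delete-image v ((y , t) ∷ g) with y ≟ v
... | yes refl rewrite deleteEntry-self y t = delete-image y g
... | no y≢v rewrite deleteEntry-other {v} {y} t y≢v = (refl , inj₂ refl) ∷ delete-image v g

lower-mono-< : ∀ v a b → a ≢ v → b ≢ v → a < b → lower v a < lower v b
lower-mono-< v a b a≢v b≢v a<b with <-cmp a v | <-cmp b v
... | tri≈ _ e _ | _ = ⊥-elim (a≢v e)
... | _ | tri≈ _ e _ = ⊥-elim (b≢v e)
... | tri< a<v _ _ | tri< b<v _ _ rewrite lower-≤ (<⇒≤ a<v) | lower-≤ (<⇒≤ b<v) = a<b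
... | tri< a<v _ _ | tri> _ _ v<b rewrite lower-≤ (<⇒≤ a<v) | lower-> v<b =
  ≤-trans a<v (≤-pred (subst (suc v ≤_) (sym (suc-pred-pos (≤-trans (s≤s z≤n) v<b))) v<b))
... | tri> _ _ v<a | tri< b<v _ _ = ⊥-elim (<-asym (<-trans b<v v<a) a<b)
... | tri> _ _ v<a | tri> _ _ v<b rewrite lower-> v<a | lower-> v<b = pred-mono-pos (≤-trans (s≤s z≤n) v<a) a<b

delete-monotonePattern : ∀ v g → MonotonePattern (delete v g) g
delete-monotonePattern v g = withoutValue v g , withoutValue-⊆ v g , lower v , delete-image v g ,
  λ {a} {b} a∈ b∈ a<b → lower-mono-< v a b (withoutValue-∉ v g a∈) (withoutValue-∉ v g b∈) a<b

deleteAll-monotonePattern : ∀ W g → MonotonePattern (deleteAll W g) g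
deleteAll-monotonePattern [] g = relaxation⇒monotonePattern (PW.refl (refl , inj₂ refl))
deleteAll-monotonePattern (v ∷ W) g = MonotonePattern-trans (deleteAll-monotonePattern W (delete v g)) (delete-monotonePattern v g)

monotone-⇔ : ∀ h xs {a b} → StrictlyMonotoneOn h xs → a ∈ xs → b ∈ xs → (h a < h b) ⇔ (a < b)
monotone-⇔ h xs {a} {b} mono a∈ b∈ = mk⇔ reflects (mono a∈ b∈)
  where
  reflects : h a < h b → a < b
  reflects ha<hb with <-cmp a b
  ... | tri< a<b _ _ = a<b
  ... | tri≈ _ refl _ = ⊥-elim (<-irrefl refl ha<hb)
  ... | tri> _ _ b<a = ⊥-elim (<-asym ha<hb (mono b∈ a∈ b<a))

orderIso-image : ∀ {h} σ τ' → Pointwise (ImageUnder h) σ τ' → StrictlyMonotoneOn h (vals τ') → OrderIso (vals σ) (vals τ')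
orderIso-image [] [] [] mono = oi-nil
orderIso-image ((x , s) ∷ σ) ((y , t) ∷ τ') ((refl , _) ∷ pw) mono =
  oi-cons (compare-head σ τ' pw there) (orderIso-image σ τ' pw (λ a∈ b∈ → mono (there a∈) (there b∈)))
  where
  compare-head : ∀ σ' τ'' → Pointwise (ImageUnder _) σ' τ'' → (∀ {b} → b ∈ vals τ'' → b ∈ vals ((y , t) ∷ τ')) →
    Pointwise (λ x' y' → ((_ < x') ⇔ (y < y')) × ((x' < _) ⇔ (y' < y))) (vals σ') (vals τ'')
  compare-head [] [] [] _ = []
  compare-head ((x' , _) ∷ σ') ((y' , _) ∷ τ'') ((refl , _) ∷ pw') inc =
    (monotone-⇔ _ (vals ((y , t) ∷ τ')) mono (here refl) (inc (here refl)) ,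
     monotone-⇔ _ (vals ((y , t) ∷ τ')) mono (inc (here refl)) (here refl)) ∷ compare-head σ' τ'' pw' (λ b∈ → inc (there b∈))

monotonePattern⇒isPattern : ∀ {σ τ} → MonotonePattern σ τ → IsPattern σ τ
monotonePattern⇒isPattern {σ} (τ' , s , h , pw , mono) = τ' , s , orderIso-image σ τ' pw mono , PW.map proj₂ pw

-- Replacing the dots of a word sortable by k reversals

Relaxes-flip : ∀ {e f} → Relaxes e f → Relaxes (flipEntry e) (flipEntry f)
Relaxes-flip {x , dot} {y , t} (q , inj₁ refl) = q , inj₁ refl
Relaxes-flip {x , s} {y , t} (q , inj₂ refl) = q , inj₂ refl

Pointwise-take : ∀ {R : Entry → Entry → Set} j {xs ys} → Pointwise R xs ys → Pointwise R (take j xs) (take j ys)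
Pointwise-take zero p = []
Pointwise-take (suc j) [] = []
Pointwise-take (suc j) (r ∷ p) = r ∷ Pointwise-take j p

Pointwise-drop : ∀ {R : Entry → Entry → Set} j {xs ys} → Pointwise R xs ys → Pointwise R (drop j xs) (drop j ys)
Pointwise-drop zero p = p
Pointwise-drop (suc j) [] = []
Pointwise-drop (suc j) (r ∷ p) = Pointwise-drop j p

Relaxes-prefixRev : ∀ j {xs ys} → Pointwise Relaxes xs ys → Pointwise Relaxes (prefixRev j xs) (prefixRev j ys)
Relaxes-prefixRev j p = PW.++⁺ (PW.map⁺ flipEntry flipEntry (PW.map Relaxes-flip (PW.reverse⁺ (Pointwise-take j p)))) (Pointwise-drop j p)

Relaxes-applyRevs : ∀ js {xs ys} → Pointwise Relaxes xs ys → Pointwise Relaxes (applyRevs xs js) (applyRevs ys js)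
Relaxes-applyRevs [] p = p
Relaxes-applyRevs (j ∷ js) p = Relaxes-applyRevs js (Relaxes-prefixRev j p)

-- A relaxation breaks at most the strips that the original breaks.
cc-relax : ∀ {xs ys} → Pointwise Relaxes xs ys → CleanCompact xs → CleanCompact ys
cc-relax [] c = cc-nil
cc-relax (r ∷ []) c = cc-one _
cc-relax {(a , s) ∷ (b , s') ∷ xs} {(a' , t) ∷ (b' , t') ∷ ys} ((refl , o₁) ∷ (refl , o₂) ∷ p) (cc-cons _ _ _ ¬inc ¬dec c) =
  cc-cons _ _ _ (λ { (q , u , v) → ¬inc (q , ≢neg {a} {a'} o₁ u , ≢neg {b} {b'} o₂ v) })
                (λ { (q , u , v) → ¬dec (q , ≢pos {a} {a'} o₁ u , ≢pos {b} {b'} o₂ v) })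
                (cc-relax ((refl , o₂) ∷ p) c)
  where
  ≢neg : ∀ {x y} {s t : Sign} → SignOK (x , s) (y , t) → t ≢ neg → s ≢ neg
  ≢neg (inj₁ refl) _ = λ ()
  ≢neg (inj₂ refl) t≢neg = t≢neg
  ≢pos : ∀ {x y} {s t : Sign} → SignOK (x , s) (y , t) → t ≢ pos → s ≢ pos
  ≢pos (inj₁ refl) _ = λ ()
  ≢pos (inj₂ refl) t≢pos = t≢pos

undot : Entry → Entry
undot (x , dot) = (x , pos)
undot e = e

Relaxes-undot : ∀ z → Pointwise Relaxes z (map undot z)
Relaxes-undot [] = []
Relaxes-undot ((x , pos) ∷ z) = (refl , inj₂ refl) ∷ Relaxes-undot z
Relaxes-undot ((x , neg) ∷ z) = (refl , inj₂ refl) ∷ Relaxes-undot z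
Relaxes-undot ((x , dot) ∷ z) = (refl , inj₁ refl) ∷ Relaxes-undot z

undot-identity : ∀ z → IsIdentityPeg z → IsIdentityPeg (map undot z)
undot-identity z (sorted , no-neg) =
  trans (vals-undot z) (trans sorted (cong oneTo (sym (length-map undot z)))) , undot-no-neg z no-neg
  where
  vals-undot : ∀ z → vals (map undot z) ≡ vals z
  vals-undot [] = refl
  vals-undot ((x , pos) ∷ z) = cong (x ∷_) (vals-undot z)
  vals-undot ((x , neg) ∷ z) = cong (x ∷_) (vals-undot z)
  vals-undot ((x , dot) ∷ z) = cong (x ∷_) (vals-undot z)
  undot-no-neg : ∀ z → All (λ e → proj₂ e ≢ neg) z → All (λ e → proj₂ e ≢ neg) (map undot z)
  undot-no-neg [] [] = []
  undot-no-neg ((x , pos) ∷ z) (n ∷ a) = n ∷ undot-no-neg z a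
  undot-no-neg ((x , neg) ∷ z) (n ∷ a) = n ∷ undot-no-neg z a
  undot-no-neg ((x , dot) ∷ z) (n ∷ a) = (λ ()) ∷ undot-no-neg z a

undot-undotted : ∀ z → All Undotted (map undot z)
undot-undotted [] = []
undot-undotted ((x , pos) ∷ z) = (λ ()) ∷ undot-undotted z
undot-undotted ((x , neg) ∷ z) = (λ ()) ∷ undot-undotted z
undot-undotted ((x , dot) ∷ z) = (λ ()) ∷ undot-undotted z

-- Replace the dots of the sorted word by + and undo the reversals: q relaxes the resulting
-- undotted word, which the same reversals sort.
undotted-refinement : ∀ q js → CleanCompact q → IsIdentityPeg (applyRevs q js) →
  ∃ λ q⁺ → Pointwise Relaxes q q⁺ × All Undotted q⁺ × CleanCompact q⁺ × IsIdentityPeg (applyRevs q⁺ js)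
undotted-refinement q js cc i = q⁺ , relaxes , undotted , cc-relax relaxes cc , sorted
  where
  z = applyRevs q js
  q⁺ = applyRevs (map undot z) (reverse js)
  relaxes : Pointwise Relaxes q q⁺
  relaxes = subst (λ u → Pointwise Relaxes u q⁺) (applyRevs-reverse js q) (Relaxes-applyRevs (reverse js) (Relaxes-undot z))
  undotted : All Undotted q⁺
  undotted = All-applyRevs Undotted-flipClosed (map undot z) (reverse js) (undot-undotted z)
  sorted : IsIdentityPeg (applyRevs q⁺ js)
  sorted = subst IsIdentityPeg
    (sym (trans (cong (applyRevs q⁺) (sym (reverse-involutive js))) (applyRevs-reverse (reverse js) (map undot z))))
    (undot-identity z i)

indicator : ∀ {A : Set} → Dec A → ℕ
indicator (yes _) = 1
indicator (no _) = 0

indicator-⇔ : ∀ {A B : Set} → (A ⇔ B) → (a : Dec A) (b : Dec B) → indicator a ≡ indicator b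
indicator-⇔ e (yes _) (yes _) = refl
indicator-⇔ e (no _) (no _) = refl
indicator-⇔ e (yes a) (no ¬b) = ⊥-elim (¬b (Equivalence.to e a))
indicator-⇔ e (no ¬a) (yes b) = ⊥-elim (¬a (Equivalence.from e b))

indicator-irrefl : ∀ x → indicator (x <? x) ≡ 0
indicator-irrefl x with x <? x
... | yes x<x = ⊥-elim (<-irrefl refl x<x)
... | no _ = refl

rank : ℕ → List ℕ → ℕ
rank x [] = 0
rank x (y ∷ ys) = indicator (y <? x) + rank x ys

rank-pointwise : ∀ {x y xs ys} → Pointwise (λ x' y' → (x' < x) ⇔ (y' < y)) xs ys → rank x xs ≡ rank y ys
rank-pointwise [] = refl
rank-pointwise {x} {y} {x' ∷ _} {y' ∷ _} (e ∷ p) = cong₂ _+_ (indicator-⇔ e (x' <? x) (y' <? y)) (rank-pointwise p)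

orderIso⇒rank : ∀ {xs ys} → OrderIso xs ys → Pointwise (λ x y → rank x xs ≡ rank y ys) xs ys
orderIso⇒rank oi-nil = []
orderIso⇒rank {x ∷ xs} {y ∷ ys} (oi-cons pw oi) =
  trans (cong (_+ rank x xs) (indicator-irrefl x)) (trans (rank-pointwise (PW.map proj₂ pw)) (sym (cong (_+ rank y ys) (indicator-irrefl y))))
  ∷ add-head pw (orderIso⇒rank oi)
  where
  add-head : ∀ {as bs} → Pointwise (λ x' y' → ((x < x') ⇔ (y < y')) × ((x' < x) ⇔ (y' < y))) as bs →
    Pointwise (λ x' y' → rank x' xs ≡ rank y' ys) as bs →
    Pointwise (λ x' y' → rank x' (x ∷ xs) ≡ rank y' (y ∷ ys)) as bs
  add-head [] [] = []
  add-head {x' ∷ _} {y' ∷ _} ((above , _) ∷ p) (r ∷ q) = cong₂ _+_ (indicator-⇔ above (x <? x') (y <? y')) r ∷ add-head p q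

rank-↭ : ∀ x {xs ys} → xs ↭ ys → rank x xs ≡ rank x ys
rank-↭ x ↭.refl = refl
rank-↭ x (↭.prep y p) = cong (indicator (y <? x) +_) (rank-↭ x p)
rank-↭ x (↭.swap a b p) =
  trans (x+[y+z]≡y+[x+z] (indicator (a <? x)) (indicator (b <? x)) _) (cong (λ z → indicator (b <? x) + (indicator (a <? x) + z)) (rank-↭ x p))
  where
  x+[y+z]≡y+[x+z] : ∀ u v r → u + (v + r) ≡ v + (u + r)
  x+[y+z]≡y+[x+z] u v r = trans (sym (+-assoc u v r)) (trans (cong (_+ r) (+-comm u v)) (+-assoc v u r))
rank-↭ x (↭.trans p q) = trans (rank-↭ x p) (rank-↭ x q)

rank-consecutive-≤ : ∀ k m x → x ≤ m → rank x (consecutive m k) ≡ 0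
rank-consecutive-≤ zero m x x≤m = refl
rank-consecutive-≤ (suc k) m x x≤m with m <? x
... | yes m<x = ⊥-elim (<-irrefl refl (≤-trans m<x x≤m))
... | no _ = rank-consecutive-≤ k (suc m) x (m≤n⇒m≤1+n x≤m)

rank-consecutive : ∀ k m x → m ≤ x → x < m + k → rank x (consecutive m k) ≡ x ∸ m
rank-consecutive zero m x m≤x x<m+0 = ⊥-elim (<-irrefl refl (≤-trans x<m+0 (≤-trans (≤-reflexive (+-identityʳ m)) m≤x)))
rank-consecutive (suc k) m x m≤x x<m+k with m <? x
... | yes m<x = trans (cong suc (rank-consecutive k (suc m) x m<x (subst (x <_) (+-suc m k) x<m+k))) (sym (+-∸-assoc 1 m<x))
... | no m≮x with m ≟ x
... | yes refl = trans (rank-consecutive-≤ k (suc m) m (n≤1+n m)) (sym (n∸n≡0 m))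
... | no m≢x = ⊥-elim (m≮x (≤∧≢⇒< m≤x m≢x))

∈-consecutive : ∀ {x : ℕ} m k → x ∈ consecutive m k → m ≤ x × x < m + k
∈-consecutive m (suc k) (here refl) = ≤-refl , subst (m <_) (sym (+-suc m k)) (s≤s (m≤m+n m k))
∈-consecutive {x} m (suc k) (there x∈) =
  let (m<x , x<) = ∈-consecutive (suc m) k x∈ in <⇒≤ m<x , subst (x <_) (sym (+-suc m k)) x<

permutation-rank : ∀ {xs n} → xs ↭ oneTo n → ∀ {x} → x ∈ xs → suc (rank x xs) ≡ x
permutation-rank {xs} {n} p {x} x∈ with ∈-consecutive 1 n (subst (x ∈_) (oneTo≡consecutive n) (Any-resp-↭ p x∈))
... | (1≤x , x≤n) =
  trans (cong suc (trans (rank-↭ x p) (trans (cong (rank x) (oneTo≡consecutive n)) (rank-consecutive n 1 x 1≤x x≤n)))) (m+[n∸m]≡n 1≤x)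

equal-ranks⇒≡ : ∀ {zs ws} xs ys → Pointwise (λ x y → rank x zs ≡ rank y ws) xs ys →
  (∀ {x} → x ∈ xs → suc (rank x zs) ≡ x) → (∀ {y} → y ∈ ys → suc (rank y ws) ≡ y) → xs ≡ ys
equal-ranks⇒≡ [] [] [] _ _ = refl
equal-ranks⇒≡ {zs} {ws} (x ∷ xs) (y ∷ ys) (r ∷ p) x-rank y-rank =
  cong₂ _∷_ (trans (sym (x-rank (here refl))) (trans (cong suc r) (y-rank (here refl))))
            (equal-ranks⇒≡ {zs} {ws} xs ys p (λ x∈ → x-rank (there x∈)) (λ y∈ → y-rank (there y∈)))

isPattern⇒length-≤ : ∀ {σ τ} → IsPattern σ τ → length σ ≤ length τ
isPattern⇒length-≤ (τ' , s , _ , pw) = ≤-trans (≤-reflexive (PW.Pointwise-length pw)) (SublistP.length-mono-≤ s)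

isPattern-same-length⇒≡ : ∀ p q → IsPattern p q → length p ≡ length q → IsPeg p → IsPeg q → All Undotted p → p ≡ q
isPattern-same-length⇒≡ p q (τ' , s , oi , pw) same-length p-peg q-peg undotted
  with PW.Pointwise-≡⇒≡ (SublistP.to-≋ (trans (sym (PW.Pointwise-length pw)) same-length) s)
... | refl = entrywise p q same-vals pw undotted
  where
  same-vals : vals p ≡ vals q
  same-vals = equal-ranks⇒≡ {vals p} {vals q} (vals p) (vals q) (orderIso⇒rank oi) (permutation-rank p-peg)
                (permutation-rank (subst (λ n → vals q ↭ oneTo n) (sym same-length) q-peg))
  entrywise : ∀ p q → vals p ≡ vals q → Pointwise SignOK p q → All Undotted p → p ≡ q
  entrywise [] [] _ [] [] = refl
  entrywise ((x , s) ∷ p) ((y , t) ∷ q) same (ok ∷ pw) (s≢dot ∷ undotted) with ∷-injective same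
  ... | refl , same' with ok
  ...   | inj₁ s≡dot = ⊥-elim (s≢dot s≡dot)
  ...   | inj₂ refl = cong ((x , s) ∷_) (entrywise p q same' pw undotted)

cleanCompact⇒patternOfGen : ∀ k q → PrdAtMost k q → CleanCompact q → ∃ λ g → Gen k g × IsPattern q g
cleanCompact⇒patternOfGen k q prd cc with prdAtMost⇒sortable k q prd
... | (js , l , i) with undotted-refinement q js cc i
... | (q⁺ , relaxes , undotted , cc⁺ , i⁺) with cleanSortable⇒deletionOfGen (length js) js q⁺ ≤-refl undotted cc⁺ i⁺
... | (g , W , G , q⁺≡) with gen-lift k G l
... | (g′ , W′ , G′ , g≡) = g′ , G′ , monotonePattern⇒isPattern
  (MonotonePattern-trans (relaxation⇒monotonePattern relaxes)
    (subst (λ z → MonotonePattern z g′) (sym q⁺≡′) (deleteAll-monotonePattern (W′ ++ W) g′)))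
  where
  q⁺≡′ : q⁺ ≡ deleteAll (W′ ++ W) g′
  q⁺≡′ = trans q⁺≡ (trans (cong (deleteAll W) g≡) (sym (deleteAll-++-values W′ W g′)))

gen-maximal : ∀ k p → GenInvariant k p → ∀ q → InB k q → CleanCompact q → IsPattern p q → p ≡ q
gen-maximal k p (sortable , undotted , _ , p-length) q (q-peg , q-prd) q-cc p⊑q =
  isPattern-same-length⇒≡ p q p⊑q (≤-antisym (isPattern⇒length-≤ p⊑q) q≤p) (sortable⇒peg k p sortable) q-peg undotted
  where
  pattern-of-gen = cleanCompact⇒patternOfGen k q q-prd q-cc
  g-length = proj₂ (proj₂ (proj₂ (gen-invariant (proj₁ (proj₂ pattern-of-gen)))))
  q≤p : length q ≤ length p
  q≤p = ≤-trans (isPattern⇒length-≤ (proj₂ (proj₂ pattern-of-gen))) (≤-reflexive (trans g-length (sym p-length)))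

G⇒maxCleanCompact : ∀ k p → G k p → MaxCleanCompact k p
G⇒maxCleanCompact k p g = (sortable⇒peg k p sortable , sortable⇒prdAtMost k p sortable) , cc , gen-maximal k p invariant
  where
  invariant = gen-invariant (G⇒Gen g)
  sortable = proj₁ invariant
  cc = proj₁ (proj₂ (proj₂ invariant))

maxCleanCompact⇒G : ∀ k p → MaxCleanCompact (suc k) p → G (suc k) p
maxCleanCompact⇒G k p ((_ , p-prd) , p-cc , maximal) = subst (G (suc k)) (sym (maximal g g∈B g-cc p⊑g)) (Gen⇒G gen)
  where
  pattern-of-gen = cleanCompact⇒patternOfGen (suc k) p p-prd p-cc
  g = proj₁ pattern-of-gen
  gen = proj₁ (proj₂ pattern-of-gen)
  p⊑g = proj₂ (proj₂ pattern-of-gen)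
  sortable = proj₁ (gen-invariant gen)
  g-cc = proj₁ (proj₂ (proj₂ (gen-invariant gen)))
  g∈B : InB (suc k) g
  g∈B = sortable⇒peg (suc k) g sortable , sortable⇒prdAtMost (suc k) g sortable

mainTheorem4 : (k : ℕ) → 1 ≤ k → (p : Word) → G k p ⇔ MaxCleanCompact k p
mainTheorem4 (suc k) _ p = mk⇔ (G⇒maxCleanCompact (suc k) p) (maxCleanCompact⇒G k p)
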